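{- (i) For integers $k\ge1$, $l\ge1$ and $0\le r\le 2k$: $f(P_{2k}\times P_{(2k+1)l+r})\le kl+\left\lceil \frac{r-1}{2}\right\rceil$. (ii) For integers $k\ge 0$, $l\ge1$ and $r\ge0$ with $0\le 2r\le 2k+1$: $f(P_{2k+1}\times P_{(2k+2)l+2r})\le kl+r$.
   Context: $P_m\times P_n$ is the $m\times n$ grid graph (Cartesian product of paths with $m$ and $n$ vertices). For a perfect matching $M$ of a graph $G$, a forcing set for $M$ is a subset $S\subseteq M$ contained in no other perfect matching of $G$; $f(G,M)$ is the minimum size of a forcing set for $M$, and $f(G)$ is the minimum of $f(G,M)$ over all perfect matchings $M$ of $G$. -}

module Defs where

open import Level using (0ℓ)
open import Data.Nat using (ℕ; suc; _≤_)
open import Data.Fin using (Fin; toℕ)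
open import Data.Product using (_×_; _,_; Σ; ∃)
open import Data.Sum using (_⊎_)
open import Data.List using (List; length)
open import Data.List.Relation.Unary.All using (All)
open import Relation.Binary.PropositionalEquality using (_≡_)

record Graph : Set₁ where
  field
    V   : Set
    Adj : V → V → Set
open Graph public

PathAdj : {n : ℕ} → Fin n → Fin n → Set
PathAdj a b = (suc (toℕ a) ≡ toℕ b) ⊎ (suc (toℕ b) ≡ toℕ a)

Grid : ℕ → ℕ → Graph
Grid m n = record
  { V   = Fin m × Fin n
  ; Adj = λ { (i , j) (i' , j') →
              (i ≡ i' × PathAdj j j') ⊎ (j ≡ j' × PathAdj i i') } }

-- A perfect matching, represented by its partner map: every vertex v is
-- matched to M v, adjacent to v, and matching is symmetric.  The edges of
-- the matching are exactly the pairs {v , M v}.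
record PerfectMatching (G : Graph) : Set where
  field
    partner    : V G → V G
    adjacent   : ∀ v → Adj G v (partner v)
    involutive : ∀ v → partner (partner v) ≡ v
open PerfectMatching public

_∈M_ : {G : Graph} → V G × V G → PerfectMatching G → Set
(u , v) ∈M M = partner M u ≡ v

SameMatching : {G : Graph} → PerfectMatching G → PerfectMatching G → Set
SameMatching {G} M M' = ∀ (v : V G) → partner M v ≡ partner M' v

IsForcingSet : (G : Graph) → PerfectMatching G → List (V G × V G) → Set
IsForcingSet G M S =
  All (λ e → e ∈M M) S ×
  (∀ (M' : PerfectMatching G) → All (λ e → e ∈M M') S → SameMatching M M')

-- f(G) ≤ b : the minimum over perfect matchings M of the minimum size of a
-- forcing set for M is at most b, i.e. some perfect matching has a forcing
-- set with at most b edges.  (A list with repeated edges only overcounts,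
-- so bounding the list length is the same as bounding the set size.)
ForcingNumber≤ : Graph → ℕ → Set
ForcingNumber≤ G b =
  Σ (PerfectMatching G) λ M →
  Σ (List (V G × V G)) λ S → IsForcingSet G M S × length S ≤ b

-- A subset S of a perfect matching M forces M as soon as the vertices can be ranked, well-foundedly,
-- so that each vertex lies on an edge of S, or its partner has smaller rank, or each of its other
-- neighbours is settled earlier (it lies on an edge of S, has smaller rank, or its partner has smaller rank):
-- by well-founded induction every perfect matching containing S then agrees with M everywhere.
--
-- On a grid the matching is given by a labelling of the cells with the direction of their partners,
-- and S consists of some marked horizontal dominoes.  Every column is swept either downwards or
-- upwards; vertices are ranked by the run of equally swept columns they lie in, then by anti-diagonal
-- in sweep order.  A few local rules between adjacent cells then imply the ranking condition.
--
-- The bounds are realised by odd blocks of size 2(m+1) × (2m+3+2p): m nested rings of dominoes around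
-- a 2 × (2p+3) core of p+1 stacked pairs of horizontal dominoes (the upper ones marked) and a vertical
-- domino.  Each ring adds one marked domino, so the block has m+1+p of them.  For (i), l such blocks
-- (one widened by 2⌊r/2⌋) stand side by side, after a column of vertical dominoes when r is odd.
-- For (ii), a column of vertical dominoes in front and a row of horizontal dominoes below give blocks
-- of odd height, which alternate with their vertical mirror images (for k = 0, one row of dominoes).

module Submission where

open import Defs
open import Level using (0ℓ)
open import Data.Bool using (Bool; true; false; T; not; _∧_; _∨_; if_then_else_)
open import Data.Bool.Properties using (T-∧)
open import Data.Empty using (⊥; ⊥-elim)
open import Data.Fin using (Fin; toℕ; fromℕ<)
open import Data.Fin.Properties using (toℕ-injective; toℕ<n; toℕ-fromℕ<)
import Data.Fin.Properties as Fin
open import Data.List using (List; []; _∷_; _++_; map; length; head; last; reverse; zip)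
open import Data.List.Membership.Propositional using (_∈_)
open import Data.List.Membership.Propositional.Properties using (∈-map⁺; ∈-++⁺ˡ; ∈-++⁺ʳ; ∈-++⁻)
open import Data.List.Properties
  using (length-++; length-map; length-reverse; map-++; ∷-injective; ++-identityʳ;
         reverse-++; unfold-reverse; reverse-involutive; last-map)
open import Data.List.Relation.Binary.Pointwise as Pointwise using (Pointwise; []; _∷_)
open import Data.List.Relation.Unary.All as All using (All; []; _∷_)
import Data.List.Relation.Unary.All.Properties as All
open import Data.List.Relation.Unary.Any using (here; there)
open import Data.List.Relation.Unary.Linked as Linked using (Linked; []; [-]; _∷_; _∷′_)
import Data.List.Relation.Unary.Linked.Properties as Linked
open import Data.Maybe using (Maybe; just)
open import Data.Maybe.Relation.Binary.Connected using (Connected; just; just-nothing)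
import Data.Maybe.Relation.Unary.All as Maybe
open import Data.Nat using (ℕ; zero; suc; pred; _+_; _*_; _∸_; _⊓_; _<_; _≤_; _/_; s≤s; z≤n)
open import Data.Nat.DivMod using (m/n≡1+[m∸n]/n)
open import Data.Nat.Induction using (<-wellFounded)
open import Data.Nat.ListAction using (sum)
open import Data.Nat.ListAction.Properties using (sum-++)
open import Data.Nat.Properties
  using (+-assoc; +-comm; +-identityʳ; +-suc; +-monoʳ-<; +-∸-assoc; ∸-monoʳ-<; <-trans; ≤-pred;
         ≤-refl; ≤-reflexive; ≤-trans; n<1+n; suc-injective; m≤n⇒m<n∨m≡n; m⊓n≤n; m≤n⇒m⊓n≡m;
         +-commutativeSemigroup)
open import Algebra.Properties.CommutativeSemigroup +-commutativeSemigroup using (interchange)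
open import Data.Nat.Tactic.RingSolver using (solve-∀)
open import Data.Product using (_×_; _,_; proj₁; proj₂; ∃)
import Data.Product.Properties as Product
open import Data.Product.Relation.Binary.Lex.Strict using (×-Lex; ×-wellFounded)
open import Data.Sum using (_⊎_; inj₁; inj₂)
open import Data.Unit using (tt)
open import Function using (_∘_; flip; Equivalence)
open import Induction.WellFounded using (WellFounded)
import Induction.WellFounded as WF
open import Relation.Binary.Core using (Rel)
open import Relation.Binary.Definitions using (DecidableEquality)
open import Relation.Binary.Construct.On as On using ()
open import Relation.Binary.PropositionalEquality
open import Relation.Nullary using (Dec; yes; no)
open import Relation.Nullary.Decidable using (True; toWitness; T?)

-- Forcing by a well-founded ranking

module ForcingByRank {G : Graph} (M : PerfectMatching G) (S : List (V G × V G)) where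

  Pinned : V G → Set
  Pinned v = (v , partner M v) ∈ S ⊎ (partner M v , v) ∈ S

  module _ {A : Set} {_≺_ : Rel A 0ℓ} (rank : V G → A) where

    KnownBefore : V G → V G → Set
    KnownBefore u v = Pinned v ⊎ rank v ≺ rank u ⊎ rank (partner M v) ≺ rank u

    Forced : V G → Set
    Forced u = KnownBefore u u ⊎ (∀ v → Adj G u v → v ≢ partner M u → KnownBefore u v)

    forcingByRank : DecidableEquality (V G) → WellFounded _≺_ →
                    All (_∈M M) S → (∀ u → Forced u) → IsForcingSet G M S
    forcingByRank _≟_ wf S⊆M forced = S⊆M , agrees
      where
      module _ (M' : PerfectMatching G) (S⊆M' : All (_∈M M') S) where

        Agrees : V G → Set
        Agrees v = partner M v ≡ partner M' v

        pinnedAgrees : ∀ {v} → Pinned v → Agrees v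
        pinnedAgrees (inj₁ vw∈S) = sym (All.lookup S⊆M' vw∈S)
        pinnedAgrees {v} (inj₂ wv∈S) = begin
          partner M v                          ≡⟨ sym (involutive M' _) ⟩
          partner M' (partner M' (partner M v)) ≡⟨ cong (partner M') (All.lookup S⊆M' wv∈S) ⟩
          partner M' v                         ∎
          where open ≡-Reasoning

        viaPartner : ∀ {v} → Agrees (partner M v) → Agrees v
        viaPartner {v} eq = begin
          partner M v                          ≡⟨ sym (involutive M' _) ⟩
          partner M' (partner M' (partner M v)) ≡⟨ cong (partner M') (sym eq) ⟩
          partner M' (partner M (partner M v))  ≡⟨ cong (partner M') (involutive M v) ⟩
          partner M' v                         ∎
          where open ≡-Reasoning

        known : ∀ {u v} → (∀ {w} → rank w ≺ rank u → Agrees w) → KnownBefore u v → Agrees v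
        known ih (inj₁ p) = pinnedAgrees p
        known ih (inj₂ (inj₁ v≺u)) = ih v≺u
        known ih (inj₂ (inj₂ Mv≺u)) = viaPartner (ih Mv≺u)

        step : ∀ u → (∀ {w} → rank w ≺ rank u → Agrees w) → Agrees u
        step u ih with forced u
        ... | inj₁ k = known ih k
        ... | inj₂ others with partner M' u ≟ partner M u
        ...   | yes eq = sym eq
        ...   | no neq = ⊥-elim (neq (begin
                  partner M' u                        ≡⟨ sym (involutive M _) ⟩
                  partner M (partner M (partner M' u)) ≡⟨ cong (partner M) w-agrees ⟩
                  partner M (partner M' (partner M' u)) ≡⟨ cong (partner M) (involutive M' u) ⟩
                  partner M u                         ∎))
          where
          open ≡-Reasoning
          w-agrees : Agrees (partner M' u)
          w-agrees = known ih (others _ (adjacent M' u) neq)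

        agrees : SameMatching M M'
        agrees = WF.All.wfRec (On.wellFounded rank wf) 0ℓ Agrees step

nth : {A : Set} → A → List A → ℕ → A
nth d []       _       = d
nth d (a ∷ as) zero    = a
nth d (a ∷ as) (suc i) = nth d as i

module _ {A : Set} {d : A} where

  All-nth : ∀ {P : A → Set} {xs i} → All P xs → i < length xs → P (nth d xs i)
  All-nth {i = zero}  (p ∷ _)  _         = p
  All-nth {i = suc i} (_ ∷ ps) (s≤s i<n) = All-nth ps i<n

  Linked-nth : ∀ {R : A → A → Set} {xs i} → Linked R xs → suc i < length xs → R (nth d xs i) (nth d xs (suc i))
  Linked-nth {i = zero}  [-]      (s≤s ())
  Linked-nth {i = zero}  (r ∷ _)  _         = r
  Linked-nth {i = suc i} (_ ∷ rs) (s≤s i<n) = Linked-nth rs i<n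

  head-nth : ∀ {P : A → Set} {xs} → Maybe.All P (head xs) → 0 < length xs → P (nth d xs 0)
  head-nth {xs = _ ∷ _} (Maybe.just p) _ = p

  last-nth : ∀ {P : A → Set} {xs n} → Maybe.All P (last xs) → length xs ≡ suc n → P (nth d xs n)
  last-nth {xs = _ ∷ []}         (Maybe.just p) refl = p
  last-nth {xs = _ ∷ ys@(_ ∷ _)} {suc n} p e = last-nth {xs = ys} p (suc-injective e)

Pointwise-nth : ∀ {A B : Set} {R : A → B → Set} {d e} {xs ys i} →
                Pointwise R xs ys → i < length xs → R (nth d xs i) (nth e ys i)
Pointwise-nth {i = zero}  (r ∷ _)  _         = r
Pointwise-nth {i = suc i} (_ ∷ rs) (s≤s i<n) = Pointwise-nth rs i<n

last-++ : ∀ {A : Set} (xs : List A) {y ys} → last (xs ++ y ∷ ys) ≡ last (y ∷ ys)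
last-++ []           = refl
last-++ (_ ∷ [])     = refl
last-++ (_ ∷ x ∷ xs) = last-++ (x ∷ xs)

module _ {A : Set} where

  last-reverse : ∀ (xs : List A) → last (reverse xs) ≡ head xs
  last-reverse []       = refl
  last-reverse (x ∷ xs) = trans (cong last (unfold-reverse x xs)) (last-++ (reverse xs))

  head-reverse : ∀ (xs : List A) → head (reverse xs) ≡ last xs
  head-reverse xs = trans (sym (last-reverse (reverse xs))) (cong last (reverse-involutive xs))

  Linked-reverse : ∀ {R : A → A → Set} {xs} → Linked R xs → Linked (flip R) (reverse xs)
  Linked-reverse []                 = []
  Linked-reverse [-]                = [-]
  Linked-reverse {xs = x ∷ y ∷ xs} (r ∷ rs) =
    subst (Linked _) (sym (unfold-reverse x (y ∷ xs)))
      (Linked.++⁺ (Linked-reverse rs) (subst (λ m → Connected _ m (just x)) (sym (last-reverse (y ∷ xs))) (just r)) [-])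

  All-reverse : ∀ {P : A → Set} {xs} → All P xs → All P (reverse xs)
  All-reverse []                = []
  All-reverse {xs = x ∷ xs} (p ∷ ps) = subst (All _) (sym (unfold-reverse x xs)) (All.++⁺ (All-reverse ps) (p ∷ []))

-- Cells and local rules

-- The order in which the cells of a column are forced.
data Sweep : Set where
  ↓ ↑ : Sweep

data Dir : Set where
  right left down up : Dir

-- A cell points to its partner; Rˢ and Lˢ are the two ends of an edge of the forcing set.
data Cell : Set where
  R L D U Rˢ Lˢ : Cell

dir : Cell → Dir
dir R  = right
dir Rˢ = right
dir L  = left
dir Lˢ = left
dir D  = down
dir U  = up

pinned pointsRight pointsLeft pointsDown pointsUp : Cell → Bool
pinned Rˢ = true
pinned Lˢ = true
pinned _  = false
pointsRight R  = true
pointsRight Rˢ = true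
pointsRight _  = false
pointsLeft L  = true
pointsLeft Lˢ = true
pointsLeft _  = false
pointsDown D = true
pointsDown _ = false
pointsUp U = true
pointsUp _ = false

Not : (Cell → Bool) → Cell → Set
Not p c = T (not (p c))

consistentH consistentV : Cell → Cell → Bool
consistentH R  L  = true
consistentH Rˢ Lˢ = true
consistentH a  b  = not (pointsRight a ∨ pointsLeft b)
consistentV D U = true
consistentV a b = not (pointsDown a ∨ pointsUp b)

-- When the partner of a cell comes later in the sweep, the other neighbour coming later must be
-- pinned or matched, earlier in the sweep, to a cell on the same anti-diagonal.
propagatesH : Sweep → Sweep → Cell → Cell → Bool
propagatesH ↓ ↓ D b = pinned b ∨ pointsUp b
propagatesH ↓ ↑ D b = pinned b
propagatesH ↑ ↑ U b = pinned b ∨ pointsDown b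
propagatesH ↑ ↓ U b = pinned b
propagatesH _ _ _ _ = true

propagatesV : Sweep → Cell → Cell → Bool
propagatesV ↓ R b = pinned b ∨ pointsLeft b
propagatesV ↑ a R = pinned a ∨ pointsLeft a
propagatesV _ _ _ = true

horizontalOK : Sweep → Sweep → Cell → Cell → Bool
horizontalOK σ τ a b = consistentH a b ∧ propagatesH σ τ a b

verticalOK : Sweep → Cell → Cell → Bool
verticalOK σ a b = consistentV a b ∧ propagatesV σ a b

module _ {σ τ : Sweep} where

  eastMate : ∀ {a b} → T (horizontalOK σ τ a b) → dir a ≡ right → dir b ≡ left
  eastMate {R}  {L}  _ _ = refl
  eastMate {Rˢ} {Lˢ} _ _ = refl

  westMate : ∀ {a b} → T (horizontalOK σ τ a b) → dir b ≡ left → dir a ≡ right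
  westMate {R}  {L}  _ _ = refl
  westMate {Rˢ} {Lˢ} _ _ = refl

  pinnedWestMate : ∀ {a} → T (horizontalOK σ τ a Lˢ) → a ≡ Rˢ
  pinnedWestMate {Rˢ} _ = refl

module _ {σ : Sweep} where

  southMate : ∀ {a b} → T (verticalOK σ a b) → dir a ≡ down → dir b ≡ up
  southMate {D} {U} _ _ = refl

  northMate : ∀ {a b} → T (verticalOK σ a b) → dir b ≡ up → dir a ≡ down
  northMate {D} {U} _ _ = refl

eastOfDown : ∀ {τ b} → T (horizontalOK ↓ τ D b) → T (pinned b) ⊎ (τ ≡ ↓ × dir b ≡ up)
eastOfDown {↓} {U}  _ = inj₂ (refl , refl)
eastOfDown {_} {Rˢ} _ = inj₁ tt

eastOfUp : ∀ {τ b} → T (horizontalOK ↑ τ U b) → T (pinned b) ⊎ (τ ≡ ↑ × dir b ≡ down)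
eastOfUp {↑} {D}  _ = inj₂ (refl , refl)
eastOfUp {_} {Rˢ} _ = inj₁ tt

southOfRight : ∀ {b} → T (verticalOK ↓ R b) → T (pinned b) ⊎ dir b ≡ left
southOfRight {L}  _ = inj₂ refl
southOfRight {Rˢ} _ = inj₁ tt
southOfRight {Lˢ} _ = inj₁ tt

northOfRight : ∀ {a} → T (verticalOK ↑ a R) → T (pinned a) ⊎ dir a ≡ left
northOfRight {L}  _ = inj₂ refl
northOfRight {Rˢ} _ = inj₁ tt
northOfRight {Lˢ} _ = inj₁ tt

robustH : Cell → Cell → Bool
robustH a b = horizontalOK ↓ ↓ a b ∧ horizontalOK ↓ ↑ a b ∧ horizontalOK ↑ ↓ a b ∧ horizontalOK ↑ ↑ a b

robustV : Cell → Cell → Bool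
robustV a b = verticalOK ↓ a b ∧ verticalOK ↑ a b

private
  split : ∀ {x y} → T (x ∧ y) → T x × T y
  split = Equivalence.to T-∧

robustH-ok : ∀ {a b} → T (robustH a b) → ∀ σ τ → T (horizontalOK σ τ a b)
robustH-ok {a} {b} ok σ τ with split {horizontalOK ↓ ↓ a b} ok
... | ↓↓ , rest with split {horizontalOK ↓ ↑ a b} rest
... | ↓↑ , rest′ with split {horizontalOK ↑ ↓ a b} rest′
... | ↑↓ , ↑↑ with σ | τ
... | ↓ | ↓ = ↓↓
... | ↓ | ↑ = ↓↑
... | ↑ | ↓ = ↑↓
... | ↑ | ↑ = ↑↑

robustV-ok : ∀ {a b} → T (robustV a b) → ∀ σ → T (verticalOK σ a b)
robustV-ok {a} {b} ok ↓ = proj₁ (split {verticalOK ↓ a b} ok)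
robustV-ok {a} {b} ok ↑ = proj₂ (split {verticalOK ↓ a b} ok)

allCells : List Cell
allCells = R ∷ L ∷ D ∷ U ∷ Rˢ ∷ Lˢ ∷ []

every-cell : ∀ c → c ∈ allCells
every-cell R  = here refl
every-cell L  = there (here refl)
every-cell D  = there (there (here refl))
every-cell U  = there (there (there (here refl)))
every-cell Rˢ = there (there (there (there (here refl))))
every-cell Lˢ = there (there (there (there (there (here refl)))))

forEvery : (p : Cell → Bool) → {True (All.all? (T? ∘ p) allCells)} → ∀ c → T (p c)
forEvery p {ok} c = All.lookup (toWitness ok) (every-cell c)

forEvery₂ : (p : Cell → Cell → Bool) → {True (All.all? (λ a → All.all? (T? ∘ p a) allCells) allCells)} →
            ∀ a b → T (p a b)
forEvery₂ p {ok} a b = All.lookup (All.lookup (toWitness ok) (every-cell a)) (every-cell b)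

_⇒ᵇ_ : Bool → Bool → Bool
x ⇒ᵇ y = not x ∨ y

modusPonens : ∀ {x y} → T (x ⇒ᵇ y) → T x → T y
modusPonens {true} t _ = t

mirror : Cell → Cell
mirror D = U
mirror U = D
mirror c = c

opposite : Sweep → Sweep
opposite ↓ = ↑
opposite ↑ = ↓

mirror-vertical : ∀ σ {a b} → T (verticalOK σ a b) → T (verticalOK (opposite σ) (mirror b) (mirror a))
mirror-vertical σ {a} {b} = modusPonens (byCases σ a b)
  where
  preserved : Sweep → Cell → Cell → Bool
  preserved σ a b = verticalOK σ a b ⇒ᵇ verticalOK (opposite σ) (mirror b) (mirror a)
  byCases : ∀ σ a b → T (preserved σ a b)
  byCases ↓ = forEvery₂ (preserved ↓)
  byCases ↑ = forEvery₂ (preserved ↑)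

mirror-horizontal : ∀ σ τ {a b} → T (horizontalOK σ τ a b) →
                    T (horizontalOK (opposite σ) (opposite τ) (mirror a) (mirror b))
mirror-horizontal σ τ {a} {b} = modusPonens (byCases σ τ a b)
  where
  preserved : Sweep → Sweep → Cell → Cell → Bool
  preserved σ τ a b = horizontalOK σ τ a b ⇒ᵇ horizontalOK (opposite σ) (opposite τ) (mirror a) (mirror b)
  byCases : ∀ σ τ a b → T (preserved σ τ a b)
  byCases ↓ ↓ = forEvery₂ (preserved ↓ ↓)
  byCases ↓ ↑ = forEvery₂ (preserved ↓ ↑)
  byCases ↑ ↓ = forEvery₂ (preserved ↑ ↓)
  byCases ↑ ↑ = forEvery₂ (preserved ↑ ↑)

isRˢ : Cell → Bool
isRˢ Rˢ = true
isRˢ _  = false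

isRˢ-true : ∀ {c} → T (isRˢ c) → c ≡ Rˢ
isRˢ-true {Rˢ} _ = refl

isRˢ-mirror : ∀ c → isRˢ (mirror c) ≡ isRˢ c
isRˢ-mirror R  = refl
isRˢ-mirror L  = refl
isRˢ-mirror D  = refl
isRˢ-mirror U  = refl
isRˢ-mirror Rˢ = refl
isRˢ-mirror Lˢ = refl

-- From a valid labelling of a grid to a forcing set

_≟ˢ_ : DecidableEquality Sweep
↓ ≟ˢ ↓ = yes refl
↑ ≟ˢ ↑ = yes refl
↓ ≟ˢ ↑ = no λ ()
↑ ≟ˢ ↓ = no λ ()

clash : ∀ {b} → T b → T (not b) → ⊥
clash {true} _ ()

clamp : (n : ℕ) → ℕ → Fin (suc n)
clamp n y = fromℕ< (s≤s (m⊓n≤n y n))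

toℕ-clamp : ∀ {n y} → y ≤ n → toℕ (clamp n y) ≡ y
toℕ-clamp {n} {y} y≤n = trans (toℕ-fromℕ< _) (m≤n⇒m⊓n≡m y≤n)

clamp-toℕ : ∀ {n} (i : Fin (suc n)) → clamp n (toℕ i) ≡ i
clamp-toℕ i = toℕ-injective (toℕ-clamp (≤-pred (toℕ<n i)))

-- Positions are (row , column), counted from the north-west corner.
Pos : Set
Pos = ℕ × ℕ

Near : Pos → Pos → Set
Near (y , x) (y' , x') = (y ≡ y' × (suc x ≡ x' ⊎ suc x' ≡ x)) ⊎ (x ≡ x' × (suc y ≡ y' ⊎ suc y' ≡ y))

move : Dir → Pos → Pos
move right (y , x) = y , suc x
move left  (y , x) = y , pred x
move down  (y , x) = suc y , x
move up    (y , x) = pred y , x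

rightward : ∀ {c} → dir c ≡ right → T (pointsRight c)
rightward {R}  _ = _
rightward {Rˢ} _ = _

leftward : ∀ {c} → dir c ≡ left → T (pointsLeft c)
leftward {L}  _ = _
leftward {Lˢ} _ = _

downward : ∀ {c} → dir c ≡ down → T (pointsDown c)
downward {D} _ = _

upward : ∀ {c} → dir c ≡ up → T (pointsUp c)
upward {U} _ = _

module Labelling (h' w' : ℕ) (cell : ℕ → ℕ → Cell) (sweep : ℕ → Sweep) where

  h w : ℕ
  h = suc h'
  w = suc w'

  InRange : Pos → Set
  InRange (y , x) = y < h × x < w

  cellAt : Pos → Cell
  cellAt (y , x) = cell y x

  mate : Pos → Pos
  mate p = move (dir (cellAt p)) p

  record Valid : Set where
    field
      horizontal : ∀ {y x} → y < h → suc x < w →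
                   T (horizontalOK (sweep x) (sweep (suc x)) (cell y x) (cell y (suc x)))
      vertical   : ∀ {y x} → suc y < h → x < w → T (verticalOK (sweep x) (cell y x) (cell (suc y) x))
      westEdge   : ∀ {y} → y < h → Not pointsLeft (cell y 0)
      eastEdge   : ∀ {y} → y < h → Not pointsRight (cell y w')
      northEdge  : ∀ {x} → x < w → Not pointsUp (cell 0 x)
      southEdge  : ∀ {x} → x < w → Not pointsDown (cell h' x)

  depth : Sweep → ℕ → ℕ
  depth ↓ y = y
  depth ↑ y = h' ∸ y

  -- Within an anti-diagonal of a window, cells pointing along the sweep are ordered by depth, all
  -- others by column.
  tiebreak : Sweep → Dir → ℕ → ℕ → ℕ
  tiebreak ↓ down y x = y
  tiebreak ↑ up   y x = h' ∸ y
  tiebreak _ _    y x = x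

  window : ℕ → ℕ
  window zero = zero
  window (suc x) with sweep x ≟ˢ sweep (suc x)
  ... | yes _ = window x
  ... | no  _ = suc (window x)

  Rank : Set
  Rank = ℕ × ℕ × ℕ

  _<ₗ_ : Rel (ℕ × ℕ) 0ℓ
  _<ₗ_ = ×-Lex _≡_ _<_ _<_

  _≺_ : Rel Rank 0ℓ
  _≺_ = ×-Lex _≡_ _<_ _<ₗ_

  ≺-wellFounded : WellFounded _≺_
  ≺-wellFounded = ×-wellFounded <-wellFounded (×-wellFounded <-wellFounded <-wellFounded)

  withinWindow : Pos → ℕ × ℕ
  withinWindow (y , x) = x + depth (sweep x) y , tiebreak (sweep x) (dir (cell y x)) y x

  rank : Pos → Rank
  rank (y , x) = window x , withinWindow (y , x)

  sameWindow : ∀ {x} → sweep x ≡ sweep (suc x) → window (suc x) ≡ window x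
  sameWindow {x} e with sweep x ≟ˢ sweep (suc x)
  ... | yes _ = refl
  ... | no ne = ⊥-elim (ne e)

  nextWindow : ∀ {x} → sweep x ≢ sweep (suc x) → window x < window (suc x)
  nextWindow {x} ne with sweep x ≟ˢ sweep (suc x)
  ... | yes e = ⊥-elim (ne e)
  ... | no  _ = n<1+n _

  eastward : ∀ {y₁ y₂ x} → (sweep x ≡ sweep (suc x) → withinWindow (y₁ , x) <ₗ withinWindow (y₂ , suc x)) →
             rank (y₁ , x) ≺ rank (y₂ , suc x)
  eastward {y₁} {y₂} {x} later = byCases (sweep x ≟ˢ sweep (suc x))
    where
    byCases : Dec (sweep x ≡ sweep (suc x)) → rank (y₁ , x) ≺ rank (y₂ , suc x)
    byCases (yes same) = inj₂ (sym (sameWindow same) , later same)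
    byCases (no  diff) = inj₁ (nextWindow diff)

  westLower : ∀ {y x} → rank (y , x) ≺ rank (y , suc x)
  westLower {y} {x} = eastward λ e →
    inj₁ (subst (λ σ → x + depth (sweep x) y < suc x + depth σ y) e (n<1+n _))

  northLower : ∀ {y x} → sweep x ≡ ↓ → rank (y , x) ≺ rank (suc y , x)
  northLower {y} {x} s = inj₂ (refl , inj₁ (subst (λ σ → x + depth σ y < x + depth σ (suc y)) (sym s)
                                              (+-monoʳ-< x (n<1+n y))))

  southLower : ∀ {y x} → sweep x ≡ ↑ → suc y < h → rank (suc y , x) ≺ rank (y , x)
  southLower {y} {x} s sy<h = inj₂ (refl , inj₁ (subst (λ σ → x + depth σ (suc y) < x + depth σ y) (sym s)
                                                   (+-monoʳ-< x (∸-monoʳ-< (n<1+n y) (≤-pred sy<h)))))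

  tiebreak-right : ∀ σ {y x} → tiebreak σ right y x ≡ x
  tiebreak-right ↓ = refl
  tiebreak-right ↑ = refl

  rightTie : ∀ {y₁ y₂ x} → dir (cell y₁ x) ≡ right → dir (cell y₂ (suc x)) ≡ right →
             proj₂ (withinWindow (y₁ , x)) < proj₂ (withinWindow (y₂ , suc x))
  rightTie {y₁} {y₂} {x} d₁ d₂
    rewrite d₁ | d₂ | tiebreak-right (sweep x) {y₁} {x} | tiebreak-right (sweep (suc x)) {y₂} {suc x} = n<1+n x

  downDiagonal : ∀ {y x} → sweep x ≡ ↓ → sweep (suc x) ≡ ↓ →
                 x + depth (sweep x) (suc y) ≡ suc x + depth (sweep (suc x)) y
  downDiagonal {y} {x} s s' rewrite s | s' = +-suc x y

  upDiagonal : ∀ {y x} → sweep x ≡ ↑ → sweep (suc x) ≡ ↑ → suc y ≤ h' →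
               x + depth (sweep x) y ≡ suc x + depth (sweep (suc x)) (suc y)
  upDiagonal {y} {x} s s' sy≤h' rewrite s | s' = trans (cong (x +_) (+-∸-assoc 1 sy≤h')) (+-suc x _)

  toPos : Fin h × Fin w → Pos
  toPos (i , j) = toℕ i , toℕ j

  fromPos : Pos → Fin h × Fin w
  fromPos (y , x) = clamp h' y , clamp w' x

  toPos-inRange : ∀ v → InRange (toPos v)
  toPos-inRange (i , j) = toℕ<n i , toℕ<n j

  fromPos-toPos : ∀ v → fromPos (toPos v) ≡ v
  fromPos-toPos (i , j) = cong₂ _,_ (clamp-toℕ i) (clamp-toℕ j)

  toPos-fromPos : ∀ {p} → InRange p → toPos (fromPos p) ≡ p
  toPos-fromPos (y<h , x<w) = cong₂ _,_ (toℕ-clamp (≤-pred y<h)) (toℕ-clamp (≤-pred x<w))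

  near⇒adj : ∀ u {p} → InRange p → Near (toPos u) p → Adj (Grid h w) u (fromPos p)
  near⇒adj u r near = adj (subst (Near (toPos u)) (sym (toPos-fromPos r)) near)
    where
    adj : ∀ {v} → Near (toPos u) (toPos v) → Adj (Grid h w) u v
    adj (inj₁ (e , n)) = inj₁ (toℕ-injective e , n)
    adj (inj₂ (e , n)) = inj₂ (toℕ-injective e , n)

  adj⇒near : ∀ {u v} → Adj (Grid h w) u v → Near (toPos u) (toPos v)
  adj⇒near (inj₁ (e , n)) = inj₁ (cong toℕ e , n)
  adj⇒near (inj₂ (e , n)) = inj₂ (cong toℕ e , n)

  module _ (valid : Valid) where
    open Valid valid

    eastMateAt : ∀ {y x} → y < h → suc x < w → dir (cell y x) ≡ right → dir (cell y (suc x)) ≡ left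
    eastMateAt {y} {x} y<h x<w = eastMate {sweep x} {sweep (suc x)} {cell y x} {cell y (suc x)} (horizontal y<h x<w)

    westMateAt : ∀ {y x} → y < h → suc x < w → dir (cell y (suc x)) ≡ left → dir (cell y x) ≡ right
    westMateAt {y} {x} y<h x<w = westMate {sweep x} {sweep (suc x)} {cell y x} {cell y (suc x)} (horizontal y<h x<w)

    southMateAt : ∀ {y x} → suc y < h → x < w → dir (cell y x) ≡ down → dir (cell (suc y) x) ≡ up
    southMateAt {y} {x} y<h x<w = southMate {sweep x} {cell y x} {cell (suc y) x} (vertical y<h x<w)

    northMateAt : ∀ {y x} → suc y < h → x < w → dir (cell (suc y) x) ≡ up → dir (cell y x) ≡ down
    northMateAt {y} {x} y<h x<w = northMate {sweep x} {cell y x} {cell (suc y) x} (vertical y<h x<w)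

    pinnedWestMateAt : ∀ {y x} → y < h → suc x < w → cell y (suc x) ≡ Lˢ → cell y x ≡ Rˢ
    pinnedWestMateAt {y} {x} y<h x<w c =
      pinnedWestMate {sweep x} {sweep (suc x)}
        (subst (T ∘ horizontalOK (sweep x) (sweep (suc x)) (cell y x)) c (horizontal y<h x<w))

    record MateView (p : Pos) (d : Dir) : Set where
      field
        inRange    : InRange (move d p)
        near       : Near p (move d p)
        returns    : mate (move d p) ≡ p

    eastRoom : ∀ {y x} → y < h → x < w → dir (cell y x) ≡ right → suc x < w
    eastRoom y<h x<w d with m≤n⇒m<n∨m≡n (≤-pred x<w)
    ... | inj₁ x<w' = s≤s x<w'
    ... | inj₂ refl = ⊥-elim (clash (rightward d) (eastEdge y<h))

    southRoom : ∀ {y x} → y < h → x < w → dir (cell y x) ≡ down → suc y < h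
    southRoom y<h x<w d with m≤n⇒m<n∨m≡n (≤-pred y<h)
    ... | inj₁ y<h' = s≤s y<h'
    ... | inj₂ refl = ⊥-elim (clash (downward d) (southEdge x<w))

    view : ∀ y x → InRange (y , x) → ∀ d → dir (cell y x) ≡ d → MateView (y , x) d
    view y x (y<h , x<w) right d = record
      { inRange    = y<h , sx<w
      ; near       = inj₁ (refl , inj₁ refl)
      ; returns    = cong (λ d → move d (y , suc x)) (eastMateAt y<h sx<w d)
      }
      where sx<w = eastRoom y<h x<w d
    view y zero (y<h , _) left d = ⊥-elim (clash (leftward d) (westEdge y<h))
    view y (suc x) (y<h , x<w) left d = record
      { inRange    = y<h , <-trans (n<1+n x) x<w
      ; near       = inj₁ (refl , inj₂ refl)
      ; returns    = cong (λ d → move d (y , x)) (westMateAt y<h x<w d)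
      }
    view y x (y<h , x<w) down d = record
      { inRange    = sy<h , x<w
      ; near       = inj₂ (refl , inj₁ refl)
      ; returns    = cong (λ d → move d (suc y , x)) (southMateAt sy<h x<w d)
      }
      where sy<h = southRoom y<h x<w d
    view zero x (_ , x<w) up d = ⊥-elim (clash (upward d) (northEdge x<w))
    view (suc y) x (y<h , x<w) up d = record
      { inRange    = <-trans (n<1+n y) y<h , x<w
      ; near       = inj₂ (refl , inj₂ refl)
      ; returns    = cong (λ d → move d (y , x)) (northMateAt y<h x<w d)
      }

    mateView : ∀ {p} → InRange p → MateView p (dir (cellAt p))
    mateView {y , x} r = view y x r (dir (cell y x)) refl

    matching : PerfectMatching (Grid h w)
    matching = record
      { partner    = λ v → fromPos (mate (toPos v))
      ; adjacent   = λ v → let open MateView (mateView (toPos-inRange v)) in near⇒adj v inRange near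
      ; involutive = λ v → let open MateView (mateView (toPos-inRange v)) in begin
          fromPos (mate (toPos (fromPos (mate (toPos v))))) ≡⟨ cong (fromPos ∘ mate) (toPos-fromPos inRange) ⟩
          fromPos (mate (mate (toPos v)))                   ≡⟨ cong fromPos returns ⟩
          fromPos (toPos v)                                 ≡⟨ fromPos-toPos v ⟩
          v                                                 ∎
      }
      where open ≡-Reasoning

    Known : Pos → Pos → Set
    Known p q = T (pinned (cellAt q)) ⊎ rank q ≺ rank p ⊎ rank (mate q) ≺ rank p

    ForcedAt : Pos → Set
    ForcedAt p = Known p p ⊎ (∀ q → InRange q → Near p q → q ≢ mate p → Known p q)

    mateTowards : ∀ {p d} → dir (cellAt p) ≡ d → mate p ≡ move d p
    mateTowards {p} e = cong (λ d → move d p) e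

    record Sides (y x : ℕ) : Set where
      field
        east  : suc x < w → (y , suc x) ≢ mate (y , x) → Known (y , x) (y , suc x)
        south : suc y < h → (suc y , x) ≢ mate (y , x) → Known (y , x) (suc y , x)
        north : ∀ {y₀} → y ≡ suc y₀ → (y₀ , x) ≢ mate (y , x) → Known (y , x) (y₀ , x)

    bySides : ∀ {y x} → Sides y x → ForcedAt (y , x)
    bySides sides = inj₂ (neighbours sides)
      where
      neighbours : ∀ {y x} → Sides y x → ∀ q → InRange q → Near (y , x) q → q ≢ mate (y , x) → Known (y , x) q
      neighbours s _ (_ , x<w) (inj₁ (refl , inj₁ refl)) ne = Sides.east s x<w ne
      neighbours s _ _         (inj₁ (refl , inj₂ refl)) _  = inj₂ (inj₁ westLower)
      neighbours s _ (y<h , _) (inj₂ (refl , inj₁ refl)) ne = Sides.south s y<h ne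
      neighbours s _ _         (inj₂ (refl , inj₂ refl)) ne = Sides.north s refl ne

    isMate : ∀ {p q} → mate p ≡ q → q ≢ mate p → Known p q
    isMate e ne = ⊥-elim (ne (sym e))

    rightDownward : ∀ {y x} → InRange (y , x) → cell y x ≡ R → sweep x ≡ ↓ → ForcedAt (y , x)
    rightDownward {y} {x} (_ , x<w) c s = bySides record
      { east  = λ _ → isMate (mateTowards (cong dir c))
      ; south = λ sy<h _ → below sy<h
      ; north = λ { refl _ → inj₂ (inj₁ (northLower s)) }
      }
      where
      diagonal : ∀ {x} → suc y < h → x < w → cell y x ≡ R → sweep x ≡ ↓ → dir (cell (suc y) x) ≡ left →
                 rank (mate (suc y , x)) ≺ rank (y , x)
      diagonal {zero} sy<h _ _ _ l = ⊥-elim (clash (leftward l) (westEdge sy<h))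
      diagonal {suc x₀} sy<h x<w c s l =
        subst (λ q → rank q ≺ rank (y , suc x₀)) (sym (mateTowards l))
          (eastward λ e → inj₂ (downDiagonal (trans e s) s , rightTie (westMateAt sy<h x<w l) (cong dir c)))
      below : suc y < h → Known (y , x) (suc y , x)
      below sy<h with southOfRight (subst₂ (λ σ a → T (verticalOK σ a (cell (suc y) x))) s c (vertical sy<h x<w))
      ... | inj₁ pin = inj₁ pin
      ... | inj₂ l   = inj₂ (inj₂ (diagonal sy<h x<w c s l))

    downDownward : ∀ {y x} → InRange (y , x) → cell y x ≡ D → sweep x ≡ ↓ → ForcedAt (y , x)
    downDownward {y} {x} (y<h , _) c s = bySides record
      { east  = λ sx<w _ → beside sx<w
      ; south = λ _ → isMate (mateTowards (cong dir c))
      ; north = λ { refl _ → inj₂ (inj₁ (northLower s)) }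
      }
      where
      diagonal : ∀ {y} → y < h → suc x < w → cell y x ≡ D → sweep (suc x) ≡ ↓ → dir (cell y (suc x)) ≡ up →
                 rank (mate (y , suc x)) ≺ rank (y , x)
      diagonal {zero} _ sx<w _ _ u = ⊥-elim (clash (upward u) (northEdge sx<w))
      diagonal {suc y₀} y<h sx<w c s' u =
        subst (λ q → rank q ≺ rank (suc y₀ , x)) (sym (mateTowards u))
          (inj₂ (sameWindow (trans s (sym s')) , inj₂ (sym (downDiagonal s s') , tie)))
        where
        tie : proj₂ (withinWindow (y₀ , suc x)) < proj₂ (withinWindow (suc y₀ , x))
        tie rewrite s | s' | northMateAt y<h sx<w u | c = n<1+n y₀
      beside : suc x < w → Known (y , x) (y , suc x)
      beside sx<w with eastOfDown (subst₂ (λ σ a → T (horizontalOK σ (sweep (suc x)) a (cell y (suc x)))) s c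
                                          (horizontal y<h sx<w))
      ... | inj₁ pin       = inj₁ pin
      ... | inj₂ (s' , u) = inj₂ (inj₂ (diagonal y<h sx<w c s' u))

    rightUpward : ∀ {y x} → InRange (y , x) → cell y x ≡ R → sweep x ≡ ↑ → ForcedAt (y , x)
    rightUpward {y} {x} (y<h , x<w) c s = bySides record
      { east  = λ _ → isMate (mateTowards (cong dir c))
      ; south = λ sy<h _ → inj₂ (inj₁ (southLower s sy<h))
      ; north = λ { refl _ → above y<h c }
      }
      where
      diagonal : ∀ {y₀ x} → suc y₀ < h → x < w → cell (suc y₀) x ≡ R → sweep x ≡ ↑ → dir (cell y₀ x) ≡ left →
                 rank (mate (y₀ , x)) ≺ rank (suc y₀ , x)
      diagonal {_} {zero} y<h _ _ _ l = ⊥-elim (clash (leftward l) (westEdge (<-trans (n<1+n _) y<h)))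
      diagonal {y₀} {suc x₀} y<h x<w c s l =
        subst (λ q → rank q ≺ rank (suc y₀ , suc x₀)) (sym (mateTowards l))
          (eastward λ e → inj₂ (upDiagonal (trans e s) s (≤-pred y<h) ,
                                rightTie (westMateAt (<-trans (n<1+n _) y<h) x<w l) (cong dir c)))
      above : ∀ {y₀} → suc y₀ < h → cell (suc y₀) x ≡ R → Known (suc y₀ , x) (y₀ , x)
      above {y₀} y<h c with northOfRight (subst₂ (λ σ b → T (verticalOK σ (cell y₀ x) b)) s c (vertical y<h x<w))
      ... | inj₁ pin = inj₁ pin
      ... | inj₂ l   = inj₂ (inj₂ (diagonal y<h x<w c s l))

    upUpward : ∀ {y x} → InRange (y , x) → cell y x ≡ U → sweep x ≡ ↑ → ForcedAt (y , x)
    upUpward {y} {x} (y<h , _) c s = bySides record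
      { east  = λ sx<w _ → beside sx<w
      ; south = λ sy<h _ → inj₂ (inj₁ (southLower s sy<h))
      ; north = λ { refl → isMate (mateTowards (cong dir c)) }
      }
      where
      diagonal : suc x < w → sweep (suc x) ≡ ↑ → dir (cell y (suc x)) ≡ down → rank (mate (y , suc x)) ≺ rank (y , x)
      diagonal sx<w s' d =
        subst (λ q → rank q ≺ rank (y , x)) (sym (mateTowards d))
          (inj₂ (sameWindow (trans s (sym s')) , inj₂ (sym (upDiagonal s s' (≤-pred sy<h)) , tie)))
        where
        sy<h : suc y < h
        sy<h = southRoom y<h sx<w d
        tie : proj₂ (withinWindow (suc y , suc x)) < proj₂ (withinWindow (y , x))
        tie rewrite s | s' | southMateAt sy<h sx<w d | c = ∸-monoʳ-< (n<1+n y) (≤-pred sy<h)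
      beside : suc x < w → Known (y , x) (y , suc x)
      beside sx<w with eastOfUp (subst₂ (λ σ a → T (horizontalOK σ (sweep (suc x)) a (cell y (suc x)))) s c
                                        (horizontal y<h sx<w))
      ... | inj₁ pin       = inj₁ pin
      ... | inj₂ (s' , d) = inj₂ (inj₂ (diagonal sx<w s' d))

    forcedAt : ∀ {p} → InRange p → ForcedAt p
    forcedAt {y , x} r@(y<h , x<w) = byCell (cell y x) refl (sweep x) refl
      where
      byMate : rank (mate (y , x)) ≺ rank (y , x) → ForcedAt (y , x)
      byMate lt = inj₁ (inj₂ (inj₂ lt))
      byCell : ∀ a → cell y x ≡ a → ∀ σ → sweep x ≡ σ → ForcedAt (y , x)
      byCell Rˢ c _ _ = inj₁ (inj₁ (subst (T ∘ pinned) (sym c) tt))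
      byCell Lˢ c _ _ = inj₁ (inj₁ (subst (T ∘ pinned) (sym c) tt))
      byCell R  c ↓ s = rightDownward r c s
      byCell R  c ↑ s = rightUpward r c s
      byCell D  c ↓ s = downDownward r c s
      byCell U  c ↑ s = upUpward r c s
      byCell L  c _ _ = byMate (westOfMate x (cong dir c))
        where
        westOfMate : ∀ x → dir (cell y x) ≡ left → rank (mate (y , x)) ≺ rank (y , x)
        westOfMate zero l = ⊥-elim (clash (leftward l) (westEdge y<h))
        westOfMate (suc x₀) l = subst (λ q → rank q ≺ rank (y , suc x₀)) (sym (mateTowards l)) westLower
      byCell U  c ↓ s = byMate (northOfMate y (cong dir c))
        where
        northOfMate : ∀ y → dir (cell y x) ≡ up → rank (mate (y , x)) ≺ rank (y , x)
        northOfMate zero u = ⊥-elim (clash (upward u) (northEdge x<w))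
        northOfMate (suc y₀) u = subst (λ q → rank q ≺ rank (suc y₀ , x)) (sym (mateTowards u)) (northLower s)
      byCell D  c ↑ s =
        byMate (subst (λ q → rank q ≺ rank (y , x)) (sym (mateTowards d)) (southLower s (southRoom y<h x<w d)))
        where d = cong dir c

    module _ (pins : List Pos)
             (pins-sound : All (λ p → InRange p × cellAt p ≡ Rˢ) pins)
             (pins-complete : ∀ {p} → InRange p → cellAt p ≡ Rˢ → p ∈ pins) where

      pinEdges : List (Pos × Pos)
      pinEdges = map (λ p → p , move right p) pins

      pinnedEdge : ∀ {p} → InRange p → T (pinned (cellAt p)) → (p , mate p) ∈ pinEdges ⊎ (mate p , p) ∈ pinEdges
      pinnedEdge {y , x} r pin = byCell (cell y x) refl pin
        where
        byCell : ∀ a → cell y x ≡ a → T (pinned a) →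
                 ((y , x) , mate (y , x)) ∈ pinEdges ⊎ (mate (y , x) , (y , x)) ∈ pinEdges
        byCell Rˢ c _ = inj₁ (subst (λ q → ((y , x) , q) ∈ pinEdges) (sym (mateTowards (cong dir c)))
                                    (∈-map⁺ _ (pins-complete r c)))
        byCell Lˢ c _ = inj₂ (westPinned x r c)
          where
          westPinned : ∀ x → InRange (y , x) → cell y x ≡ Lˢ → (mate (y , x) , (y , x)) ∈ pinEdges
          westPinned zero (y<h , _) c = ⊥-elim (clash (subst (T ∘ pointsLeft) (sym c) tt) (westEdge y<h))
          westPinned (suc x₀) (y<h , x<w) c =
            subst (λ q → (q , (y , suc x₀)) ∈ pinEdges) (sym (mateTowards (cong dir c)))
              (∈-map⁺ _ (pins-complete (y<h , <-trans (n<1+n x₀) x<w) (pinnedWestMateAt y<h x<w c)))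

      fromEdge : Pos × Pos → (Fin h × Fin w) × (Fin h × Fin w)
      fromEdge (p , q) = fromPos p , fromPos q

      pinSet : List ((Fin h × Fin w) × (Fin h × Fin w))
      pinSet = map fromEdge pinEdges

      open ForcingByRank matching pinSet

      pinSet⊆matching : All (_∈M matching) pinSet
      pinSet⊆matching = All.map⁺ (All.map⁺ (All.map edge pins-sound))
        where
        edge : ∀ {p} → InRange p × cellAt p ≡ Rˢ → fromPos (mate (toPos (fromPos p))) ≡ fromPos (move right p)
        edge (r , c) = cong fromPos (trans (cong mate (toPos-fromPos r)) (mateTowards (cong dir c)))

      partnerPos : ∀ v → toPos (partner matching v) ≡ mate (toPos v)
      partnerPos v = toPos-fromPos (MateView.inRange (mateView (toPos-inRange v)))

      pinned⇒Pinned : ∀ v → T (pinned (cellAt (toPos v))) → Pinned v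
      pinned⇒Pinned v pin with pinnedEdge (toPos-inRange v) pin
      ... | inj₁ e = inj₁ (subst (λ u → (u , partner matching v) ∈ pinSet) (fromPos-toPos v)
                             (∈-map⁺ fromEdge e))
      ... | inj₂ e = inj₂ (subst (λ u → (partner matching v , u) ∈ pinSet) (fromPos-toPos v)
                             (∈-map⁺ fromEdge e))

      knownBefore : ∀ u v → Known (toPos u) (toPos v) → KnownBefore {_≺_ = _≺_} (rank ∘ toPos) u v
      knownBefore u v (inj₁ pin)       = inj₁ (pinned⇒Pinned v pin)
      knownBefore u v (inj₂ (inj₁ lt)) = inj₂ (inj₁ lt)
      knownBefore u v (inj₂ (inj₂ lt)) = inj₂ (inj₂ (subst (λ q → rank q ≺ rank (toPos u)) (sym (partnerPos v)) lt))

      forced : ∀ u → Forced {_≺_ = _≺_} (rank ∘ toPos) u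
      forced u with forcedAt (toPos-inRange u)
      ... | inj₁ k      = inj₁ (knownBefore u u k)
      ... | inj₂ others = inj₂ λ v adj ne →
              knownBefore u v (others (toPos v) (toPos-inRange v) (adj⇒near adj) (ne ∘ notPartner v))
        where
        notPartner : ∀ v → toPos v ≡ mate (toPos u) → v ≡ partner matching u
        notPartner v e = trans (sym (fromPos-toPos v)) (cong fromPos e)

      forcingNumber : ForcingNumber≤ (Grid h w) (length pins)
      forcingNumber =
        matching , pinSet ,
        forcingByRank (rank ∘ toPos) (Product.≡-dec Fin._≟_ Fin._≟_) ≺-wellFounded pinSet⊆matching forced ,
        ≤-reflexive (trans (length-map fromEdge pinEdges) (length-map _ pins))

-- Boards: labellings stored column by column

record Column : Set where
  constructor column
  field
    sweep : Sweep
    cells : List Cell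

open Column

Board : Set
Board = List Column

Stacked : Column → Set
Stacked c = Linked (λ a b → T (verticalOK (sweep c) a b)) (cells c)

Abut : Column → Column → Set
Abut c c' = Pointwise (λ a b → T (horizontalOK (sweep c) (sweep c') a b)) (cells c) (cells c')

record Coherent (h : ℕ) (B : Board) : Set where
  field
    heights  : All (λ c → length (cells c) ≡ h) B
    stacked  : All Stacked B
    abutting : Linked Abut B

topRow bottomRow : Board → List (Maybe Cell)
topRow    = map (head ∘ cells)
bottomRow = map (last ∘ cells)

record Framed (B : Board) : Set where
  field
    north : All (Maybe.All (Not pointsUp)) (topRow B)
    south : All (Maybe.All (Not pointsDown)) (bottomRow B)
    west  : Maybe.All (All (Not pointsLeft) ∘ cells) (head B)
    east  : Maybe.All (All (Not pointsRight) ∘ cells) (last B)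

pinCount : List Cell → ℕ
pinCount []       = 0
pinCount (c ∷ cs) = (if isRˢ c then 1 else 0) + pinCount cs

boardPinCount : Board → ℕ
boardPinCount = sum ∘ map (pinCount ∘ cells)

columnPins : ℕ → ℕ → List Cell → List Pos
columnPins x y []       = []
columnPins x y (c ∷ cs) = if isRˢ c then (y , x) ∷ columnPins x (suc y) cs else columnPins x (suc y) cs

boardPins : ℕ → Board → List Pos
boardPins x []      = []
boardPins x (c ∷ B) = columnPins x 0 (cells c) ++ boardPins (suc x) B

length-columnPins : ∀ x y cs → length (columnPins x y cs) ≡ pinCount cs
length-columnPins x y []       = refl
length-columnPins x y (c ∷ cs) with isRˢ c
... | true  = cong suc (length-columnPins x (suc y) cs)
... | false = length-columnPins x (suc y) cs

length-boardPins : ∀ x B → length (boardPins x B) ≡ boardPinCount B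
length-boardPins x []      = refl
length-boardPins x (c ∷ B) =
  trans (length-++ (columnPins x 0 (cells c))) (cong₂ _+_ (length-columnPins x 0 (cells c)) (length-boardPins (suc x) B))

columnPins-sound : ∀ {x y cs p} → p ∈ columnPins x y cs →
                   ∃ λ k → p ≡ (y + k , x) × k < length cs × nth R cs k ≡ Rˢ
columnPins-sound {x} {y} {c ∷ cs} p∈ with isRˢ c in e
columnPins-sound {x} {y} {c ∷ cs} (here refl) | true =
  0 , cong (_, x) (sym (+-identityʳ y)) , s≤s z≤n , isRˢ-true (subst T (sym e) tt)
columnPins-sound {x} {y} {c ∷ cs} (there p∈) | true with columnPins-sound {x} {suc y} {cs} p∈
... | k , refl , k< , ck = suc k , cong (_, x) (sym (+-suc y k)) , s≤s k< , ck
columnPins-sound {x} {y} {c ∷ cs} p∈ | false with columnPins-sound {x} {suc y} {cs} p∈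
... | k , refl , k< , ck = suc k , cong (_, x) (sym (+-suc y k)) , s≤s k< , ck

columnPins-complete : ∀ {x y cs k} → k < length cs → nth R cs k ≡ Rˢ → (y + k , x) ∈ columnPins x y cs
columnPins-complete {x} {y} {c ∷ cs} {zero} _ refl =
  subst (λ z → (z , x) ∈ columnPins x y (Rˢ ∷ cs)) (sym (+-identityʳ y)) (here refl)
columnPins-complete {x} {y} {c ∷ cs} {suc k} (s≤s k<) ck with isRˢ c
... | true  = there rest
  where rest = subst (λ z → (z , x) ∈ columnPins x (suc y) cs) (sym (+-suc y k)) (columnPins-complete {cs = cs} k< ck)
... | false = subst (λ z → (z , x) ∈ columnPins x (suc y) cs) (sym (+-suc y k)) (columnPins-complete {cs = cs} k< ck)

boardPins-sound : ∀ {o B p} → p ∈ boardPins o B →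
                  ∃ λ j → proj₂ p ≡ o + j × j < length B × proj₁ p < length (cells (nth (column ↓ []) B j)) ×
                          nth R (cells (nth (column ↓ []) B j)) (proj₁ p) ≡ Rˢ
boardPins-sound {o} {c ∷ B} p∈ with ∈-++⁻ (columnPins o 0 (cells c)) p∈
... | inj₁ p∈c with columnPins-sound {o} {0} {cells c} p∈c
...   | k , refl , k< , ck = 0 , sym (+-identityʳ o) , s≤s z≤n , k< , ck
boardPins-sound {o} {c ∷ B} p∈ | inj₂ p∈B with boardPins-sound {suc o} {B} p∈B
...   | j , e , j< , rest = suc j , trans e (sym (+-suc o j)) , s≤s j< , rest

boardPins-complete : ∀ {o B j k} → j < length B → k < length (cells (nth (column ↓ []) B j)) →
                     nth R (cells (nth (column ↓ []) B j)) k ≡ Rˢ → (k , o + j) ∈ boardPins o B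
boardPins-complete {o} {c ∷ B} {zero} {k} _ k< ck =
  ∈-++⁺ˡ (subst (λ x → (k , x) ∈ columnPins o 0 (cells c)) (sym (+-identityʳ o)) (columnPins-complete {cs = cells c} k< ck))
boardPins-complete {o} {c ∷ B} {suc j} {k} (s≤s j<) k< ck =
  ∈-++⁺ʳ (columnPins o 0 (cells c))
    (subst (λ x → (k , x) ∈ boardPins (suc o) B) (sym (+-suc o j)) (boardPins-complete {suc o} {B} j< k< ck))

boardForcing : ∀ {h' w'} B → length B ≡ suc w' → Coherent (suc h') B → Framed B →
               ForcingNumber≤ (Grid (suc h') (suc w')) (boardPinCount B)
boardForcing {h'} {w'} B width coherent framed =
  subst (ForcingNumber≤ (Grid (suc h') (suc w'))) (length-boardPins 0 B)
    (forcingNumber valid (boardPins 0 B) (All.tabulate sound) complete)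
  where
  open Coherent coherent
  open Framed framed
  col : ℕ → Column
  col = nth (column ↓ []) B
  open Labelling h' w' (λ y x → nth R (cells (col x)) y) (sweep ∘ col)
  inB : ∀ {x} → x < suc w' → x < length B
  inB {x} = subst (x <_) (sym width)
  height : ∀ {x} → x < suc w' → length (cells (col x)) ≡ suc h'
  height x<w = All-nth heights (inB x<w)
  inCol : ∀ {x y} → x < suc w' → y < suc h' → y < length (cells (col x))
  inCol {y = y} x<w = subst (y <_) (sym (height x<w))
  valid : Valid
  valid = record
    { horizontal = λ y<h sx<w → Pointwise-nth (Linked-nth abutting (inB sx<w)) (inCol (<-trans (n<1+n _) sx<w) y<h)
    ; vertical   = λ sy<h x<w → Linked-nth (All-nth stacked (inB x<w)) (inCol x<w sy<h)
    ; westEdge   = λ y<h → All-nth (head-nth {P = All (Not pointsLeft) ∘ cells} {xs = B} west (inB (s≤s z≤n)))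
                                   (inCol (s≤s z≤n) y<h)
    ; eastEdge   = λ y<h → All-nth (last-nth {P = All (Not pointsRight) ∘ cells} {xs = B} east width) (inCol ≤-refl y<h)
    ; northEdge  = λ x<w → head-nth (All-nth (All.map⁻ north) (inB x<w)) (inCol x<w (s≤s z≤n))
    ; southEdge  = λ {x} x<w → last-nth {xs = cells (col x)} (All-nth (All.map⁻ south) (inB x<w)) (height x<w)
    }
  sound : ∀ {p} → p ∈ boardPins 0 B → InRange p × cellAt p ≡ Rˢ
  sound {y , x} p∈ with boardPins-sound {0} {B} p∈
  ... | j , refl , j< , k< , ck = (subst (y <_) (height j<w) k< , j<w) , ck
    where j<w = subst (j <_) width j<
  complete : ∀ {p} → InRange p → cellAt p ≡ Rˢ → p ∈ boardPins 0 B
  complete (y<h , x<w) c = boardPins-complete {0} {B} (inB x<w) (inCol x<w y<h) c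

forcingBound : ∀ {h w b} B → Coherent (suc h) B → Framed B → length B ≡ suc w → boardPinCount B ≤ b →
               ForcingNumber≤ (Grid (suc h) (suc w)) b
forcingBound B coherent framed width pins≤b with boardForcing B width coherent framed
... | M , S , forcing , |S|≤pins = M , S , forcing , ≤-trans |S|≤pins pins≤b

Vertical : Sweep → Cell → Cell → Set
Vertical σ a b = T (verticalOK σ a b)

HorizontalAt : Sweep × Cell → Sweep × Cell → Set
HorizontalAt (σ , a) (τ , b) = T (horizontalOK σ τ a b)

RowChain : Board → List Cell → Set
RowChain B r = Linked HorizontalAt (zip (map sweep B) r)

TopSeam : List Cell → Board → Set
TopSeam = Pointwise (λ a c → Connected (Vertical (sweep c)) (just a) (head (cells c)))

BottomSeam : Board → List Cell → Set
BottomSeam = Pointwise (λ c b → Connected (Vertical (sweep c)) (last (cells c)) (just b))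

onTop : List Cell → Board → Board
onTop (a ∷ r) (column σ cs ∷ B) = column σ (a ∷ cs) ∷ onTop r B
onTop _       _                 = []

onBottom : List Cell → Board → Board
onBottom (b ∷ r) (column σ cs ∷ B) = column σ (cs ++ b ∷ []) ∷ onBottom r B
onBottom _       _                 = []

coherent-++ : ∀ {h A B} → Coherent h A → Coherent h B → Connected Abut (last A) (head B) → Coherent h (A ++ B)
coherent-++ a b seam = record
  { heights  = All.++⁺ (Coherent.heights a) (Coherent.heights b)
  ; stacked  = All.++⁺ (Coherent.stacked a) (Coherent.stacked b)
  ; abutting = Linked.++⁺ (Coherent.abutting a) seam (Coherent.abutting b)
  }

coherent-single : ∀ {h c} → length (cells c) ≡ h → Stacked c → Coherent h (c ∷ [])
coherent-single l s = record { heights = l ∷ [] ; stacked = s ∷ [] ; abutting = [-] }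

coherent-onTop : ∀ {h B r} → Coherent h B → length r ≡ length B → TopSeam r B → RowChain B r →
                 Coherent (suc h) (onTop r B)
coherent-onTop {h} coh e seam row = record
  { heights  = heights (Coherent.heights coh) seam
  ; stacked  = stacked (Coherent.stacked coh) seam
  ; abutting = abutting e (Coherent.abutting coh) row
  }
  where
  heights : ∀ {B r} → All (λ c → length (cells c) ≡ h) B → TopSeam r B →
            All (λ c → length (cells c) ≡ suc h) (onTop r B)
  heights [] [] = []
  heights (l ∷ ls) (_ ∷ s) = cong suc l ∷ heights ls s
  stacked : ∀ {B r} → All Stacked B → TopSeam r B → All Stacked (onTop r B)
  stacked [] [] = []
  stacked (v ∷ vs) (t ∷ s) = (t ∷′ v) ∷ stacked vs s
  abutting : ∀ {B r} → length r ≡ length B → Linked Abut B → RowChain B r → Linked Abut (onTop r B)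
  abutting {[]}          {[]}          _ _          _        = []
  abutting {_ ∷ []}      {_ ∷ []}      _ _          _        = [-]
  abutting {_ ∷ _ ∷ _}   {_ ∷ _ ∷ _}   e (ab ∷ abs) (h ∷ hs) = (h ∷ ab) ∷ abutting (suc-injective e) abs hs

coherent-onBottom : ∀ {h B r} → Coherent h B → length r ≡ length B → BottomSeam B r → RowChain B r →
                    Coherent (suc h) (onBottom r B)
coherent-onBottom {h} coh e seam row = record
  { heights  = heights (Coherent.heights coh) seam
  ; stacked  = stacked (Coherent.stacked coh) seam
  ; abutting = abutting e (Coherent.abutting coh) row
  }
  where
  heights : ∀ {B r} → All (λ c → length (cells c) ≡ h) B → BottomSeam B r →
            All (λ c → length (cells c) ≡ suc h) (onBottom r B)
  heights [] [] = []
  heights {column _ cs ∷ _} (l ∷ ls) (_ ∷ s) = trans (length-++ cs) (trans (+-comm _ 1) (cong suc l)) ∷ heights ls s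
  stacked : ∀ {B r} → All Stacked B → BottomSeam B r → All Stacked (onBottom r B)
  stacked [] [] = []
  stacked (v ∷ vs) (t ∷ s) = Linked.++⁺ v t [-] ∷ stacked vs s
  abutting : ∀ {B r} → length r ≡ length B → Linked Abut B → RowChain B r → Linked Abut (onBottom r B)
  abutting {[]}          {[]}          _ _          _        = []
  abutting {_ ∷ []}      {_ ∷ []}      _ _          _        = [-]
  abutting {_ ∷ _ ∷ _}   {_ ∷ _ ∷ _}   e (ab ∷ abs) (h ∷ hs) =
    Pointwise.++⁺ ab (h ∷ []) ∷ abutting (suc-injective e) abs hs

abut-robust : ∀ {σ τ cs ds} → Pointwise (λ a b → T (robustH a b)) cs ds → Abut (column σ cs) (column τ ds)
abut-robust {σ} {τ} = Pointwise.map (λ ok → robustH-ok ok σ τ)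

stacked-robust : ∀ {σ cs} → Linked (λ a b → T (robustV a b)) cs → Stacked (column σ cs)
stacked-robust {σ} = Linked.map (λ ok → robustV-ok ok σ)

robust-rowChain : ∀ {B r} → Linked (λ a b → T (robustH a b)) r → RowChain B r
robust-rowChain {[]}              {_}           _          = []
robust-rowChain {_ ∷ []}          {[]}          _          = []
robust-rowChain {_ ∷ []}          {_ ∷ _}       _          = [-]
robust-rowChain {_ ∷ _ ∷ _}       {[]}          _          = []
robust-rowChain {_ ∷ _ ∷ _}       {_ ∷ []}      _          = [-]
robust-rowChain {c ∷ c' ∷ B}      {_ ∷ _ ∷ _}   (h ∷ hs) =
  robustH-ok h (sweep c) (sweep c') ∷ robust-rowChain {c' ∷ B} hs

robust-topSeam : ∀ {r B t} → topRow B ≡ map just t → Pointwise (λ a b → T (robustV a b)) r t → TopSeam r B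
robust-topSeam {B = []}    {[]}    _ [] = []
robust-topSeam {B = c ∷ B} {_ ∷ _} e (v ∷ vs) =
  subst (Connected (Vertical (sweep c)) _) (sym (proj₁ (∷-injective e))) (just (robustV-ok v (sweep c)))
  ∷ robust-topSeam (proj₂ (∷-injective e)) vs

robust-bottomSeam : ∀ {B r t} → bottomRow B ≡ map just t → Pointwise (λ a b → T (robustV a b)) t r → BottomSeam B r
robust-bottomSeam {[]}    {[]}    _ [] = []
robust-bottomSeam {c ∷ B} {_ ∷ _} e (v ∷ vs) =
  subst (λ m → Connected (Vertical (sweep c)) m _) (sym (proj₁ (∷-injective e))) (just (robustV-ok v (sweep c)))
  ∷ robust-bottomSeam (proj₂ (∷-injective e)) vs

length-onTop : ∀ {r B} → length r ≡ length B → length (onTop r B) ≡ length B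
length-onTop {[]}    {[]}    _ = refl
length-onTop {_ ∷ r} {_ ∷ B} e = cong suc (length-onTop {r} {B} (suc-injective e))

length-onBottom : ∀ {r B} → length r ≡ length B → length (onBottom r B) ≡ length B
length-onBottom {[]}    {[]}    _ = refl
length-onBottom {_ ∷ r} {_ ∷ B} e = cong suc (length-onBottom {r} {B} (suc-injective e))

topRow-onTop : ∀ {r B} → length r ≡ length B → topRow (onTop r B) ≡ map just r
topRow-onTop {[]}    {[]}    _ = refl
topRow-onTop {a ∷ r} {c ∷ B} e = cong (just a ∷_) (topRow-onTop (suc-injective e))

bottomRow-onBottom : ∀ {r B} → length r ≡ length B → bottomRow (onBottom r B) ≡ map just r
bottomRow-onBottom {[]}    {[]}              _ = refl
bottomRow-onBottom {b ∷ r} {column _ cs ∷ B} e = cong₂ _∷_ (last-++ cs) (bottomRow-onBottom (suc-injective e))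

topRow-onBottom : ∀ {h r B} → length r ≡ length B → All (λ c → length (cells c) ≡ suc h) B →
                  topRow (onBottom r B) ≡ topRow B
topRow-onBottom {r = []}    {[]} _ [] = refl
topRow-onBottom {r = _ ∷ r} {column _ (c ∷ cs) ∷ B} e (_ ∷ hs) = cong (just c ∷_) (topRow-onBottom (suc-injective e) hs)

bottomRow-onTop-onBottom : ∀ {t b B} → length t ≡ length B → length b ≡ length B →
                           bottomRow (onTop t (onBottom b B)) ≡ map just b
bottomRow-onTop-onBottom {[]}    {[]}    {[]}              _ _ = refl
bottomRow-onTop-onBottom {_ ∷ t} {x ∷ b} {column _ cs ∷ B} e e' =
  cong₂ _∷_ (last-++ (_ ∷ cs)) (bottomRow-onTop-onBottom {t} {b} {B} (suc-injective e) (suc-injective e'))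

last-onTop : ∀ {r B a c} → length r ≡ length B → last r ≡ just a → last B ≡ just c →
             last (onTop r B) ≡ just (column (sweep c) (a ∷ cells c))
last-onTop {_ ∷ []}         {_ ∷ []}         _ refl refl = refl
last-onTop {_ ∷ r@(_ ∷ _)}  {_ ∷ B@(_ ∷ _)}  e ra   rb   = last-onTop {r} {B} (suc-injective e) ra rb

last-onBottom : ∀ {r B b c} → length r ≡ length B → last r ≡ just b → last B ≡ just c →
                last (onBottom r B) ≡ just (column (sweep c) (cells c ++ b ∷ []))
last-onBottom {_ ∷ []}         {_ ∷ []}         _ refl refl = refl
last-onBottom {_ ∷ r@(_ ∷ _)}  {_ ∷ B@(_ ∷ _)}  e ra   rb   = last-onBottom {r} {B} (suc-injective e) ra rb

pinCount-++ : ∀ cs ds → pinCount (cs ++ ds) ≡ pinCount cs + pinCount ds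
pinCount-++ []       ds = refl
pinCount-++ (c ∷ cs) ds = trans (cong (_ +_) (pinCount-++ cs ds)) (sym (+-assoc _ (pinCount cs) (pinCount ds)))

boardPinCount-++ : ∀ A B → boardPinCount (A ++ B) ≡ boardPinCount A + boardPinCount B
boardPinCount-++ A B = trans (cong sum (map-++ (pinCount ∘ cells) A B)) (sum-++ (map (pinCount ∘ cells) A) _)

boardPinCount-onTop : ∀ {r B} → length r ≡ length B → boardPinCount (onTop r B) ≡ pinCount r + boardPinCount B
boardPinCount-onTop {[]}    {[]}              _ = refl
boardPinCount-onTop {a ∷ r} {column σ cs ∷ B} e =
  trans (cong (pinCount (a ∷ cs) +_) (boardPinCount-onTop {r} {B} (suc-injective e)))
        (interchange (if isRˢ a then 1 else 0) (pinCount cs) (pinCount r) (boardPinCount B))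

boardPinCount-onBottom : ∀ {r B} → length r ≡ length B → boardPinCount (onBottom r B) ≡ boardPinCount B + pinCount r
boardPinCount-onBottom {[]}    {[]}              _ = sym (+-identityʳ _)
boardPinCount-onBottom {b ∷ r} {column σ cs ∷ B} e =
  trans (cong₂ _+_ (pinCount-++ cs (b ∷ [])) (boardPinCount-onBottom {r} {B} (suc-injective e)))
        (trans (interchange (pinCount cs) (pinCount (b ∷ [])) (boardPinCount B) (pinCount r))
               (cong (pinCount cs + boardPinCount B +_) (sym (pinCount-++ (b ∷ []) r))))

framed-++ : ∀ {a A b B} → Framed (a ∷ A) → Framed B → head B ≡ just b → Framed ((a ∷ A) ++ B)
framed-++ {a} {A} {b} {b ∷ B} fa fb refl = record
  { north = subst (All _) (sym (map-++ (head ∘ cells) (a ∷ A) (b ∷ B))) (All.++⁺ (Framed.north fa) (Framed.north fb))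
  ; south = subst (All _) (sym (map-++ (last ∘ cells) (a ∷ A) (b ∷ B))) (All.++⁺ (Framed.south fa) (Framed.south fb))
  ; west  = Framed.west fa
  ; east  = subst (Maybe.All _) (sym (last-++ (a ∷ A))) (Framed.east fb)
  }

flipColumn : Column → Column
flipColumn (column σ cs) = column (opposite σ) (reverse (map mirror cs))

flipBoard : Board → Board
flipBoard = map flipColumn

coherent-flip : ∀ {h B} → Coherent h B → Coherent h (flipBoard B)
coherent-flip coh = record
  { heights  = All.map⁺ (All.map (λ {c} l → trans (length-reverse (map mirror (cells c)))
                                                  (trans (length-map mirror (cells c)) l))
                                  (Coherent.heights coh))
  ; stacked  = All.map⁺ (All.map (λ {c} → stacked {c}) (Coherent.stacked coh))
  ; abutting = Linked.map⁺ (Linked.map (λ {c} {c'} → abut {c} {c'}) (Coherent.abutting coh))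
  }
  where
  stacked : ∀ {c} → Stacked c → Stacked (flipColumn c)
  stacked {column σ cs} s = Linked-reverse (Linked.map⁺ (Linked.map (mirror-vertical σ) s))
  abut : ∀ {c c'} → Abut c c' → Abut (flipColumn c) (flipColumn c')
  abut {column σ cs} {column τ ds} a =
    Pointwise.reverse⁺ (Pointwise.map⁺ mirror mirror (Pointwise.map (mirror-horizontal σ τ) a))

private
  clearUp : ∀ c → Not pointsDown c → Not pointsUp (mirror c)
  clearUp c = modusPonens (forEvery (λ c → not (pointsDown c) ⇒ᵇ not (pointsUp (mirror c))) c)

  clearDown : ∀ c → Not pointsUp c → Not pointsDown (mirror c)
  clearDown c = modusPonens (forEvery (λ c → not (pointsUp c) ⇒ᵇ not (pointsDown (mirror c))) c)

  clearLeft : ∀ c → Not pointsLeft c → Not pointsLeft (mirror c)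
  clearLeft c = modusPonens (forEvery (λ c → not (pointsLeft c) ⇒ᵇ not (pointsLeft (mirror c))) c)

  clearRight : ∀ c → Not pointsRight c → Not pointsRight (mirror c)
  clearRight c = modusPonens (forEvery (λ c → not (pointsRight c) ⇒ᵇ not (pointsRight (mirror c))) c)

  Maybe-mirror : ∀ {P Q : Cell → Set} → (∀ c → P c → Q (mirror c)) →
                 ∀ {m} → Maybe.All P m → Maybe.All Q (Data.Maybe.map mirror m)
  Maybe-mirror f (Maybe.just p) = Maybe.just (f _ p)
  Maybe-mirror f Maybe.nothing  = Maybe.nothing

  All-mirror : ∀ {P Q : Cell → Set} → (∀ c → P c → Q (mirror c)) →
               ∀ {cs} → All P cs → All Q (reverse (map mirror cs))
  All-mirror f ps = All-reverse (All.map⁺ (All.map (f _) ps))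

framed-flip : ∀ {B} → Framed B → Framed (flipBoard B)
framed-flip {B} fr = record
  { north = All.map⁺ (All.map⁺ (All.map (λ {c} → flipTop {cells c}) (All.map⁻ (Framed.south fr))))
  ; south = All.map⁺ (All.map⁺ (All.map (λ {c} → flipBottom {cells c}) (All.map⁻ (Framed.north fr))))
  ; west  = westFlip B (Framed.west fr)
  ; east  = subst (Maybe.All _) (sym (last-map flipColumn B)) (eastFlip (Framed.east fr))
  }
  where
  flipTop : ∀ {cs} → Maybe.All (Not pointsDown) (last cs) → Maybe.All (Not pointsUp) (head (reverse (map mirror cs)))
  flipTop {cs} p = subst (Maybe.All _) (sym (trans (head-reverse (map mirror cs)) (last-map mirror cs))) (Maybe-mirror clearUp p)
  flipBottom : ∀ {cs} → Maybe.All (Not pointsUp) (head cs) → Maybe.All (Not pointsDown) (last (reverse (map mirror cs)))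
  flipBottom {[]}     _              = Maybe.nothing
  flipBottom {c ∷ cs} (Maybe.just p) = subst (Maybe.All _) (sym (last-reverse (map mirror (c ∷ cs)))) (Maybe.just (clearDown c p))
  westFlip : ∀ B → Maybe.All (All (Not pointsLeft) ∘ cells) (head B) →
             Maybe.All (All (Not pointsLeft) ∘ cells) (head (flipBoard B))
  westFlip []      _              = Maybe.nothing
  westFlip (c ∷ B) (Maybe.just p) = Maybe.just (All-mirror clearLeft p)
  eastFlip : ∀ {m} → Maybe.All (All (Not pointsRight) ∘ cells) m →
             Maybe.All (All (Not pointsRight) ∘ cells) (Data.Maybe.map flipColumn m)
  eastFlip (Maybe.just p) = Maybe.just (All-mirror clearRight p)
  eastFlip Maybe.nothing  = Maybe.nothing

pinCount-reverse : ∀ cs → pinCount (reverse cs) ≡ pinCount cs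
pinCount-reverse []       = refl
pinCount-reverse (c ∷ cs) = begin
  pinCount (reverse (c ∷ cs))        ≡⟨ cong pinCount (unfold-reverse c cs) ⟩
  pinCount (reverse cs ++ c ∷ [])    ≡⟨ pinCount-++ (reverse cs) (c ∷ []) ⟩
  pinCount (reverse cs) + pinCount (c ∷ []) ≡⟨ cong₂ _+_ (pinCount-reverse cs) (+-identityʳ _) ⟩
  pinCount cs + (if isRˢ c then 1 else 0) ≡⟨ +-comm (pinCount cs) _ ⟩
  pinCount (c ∷ cs)                  ∎
  where open ≡-Reasoning

pinCount-mirror : ∀ cs → pinCount (map mirror cs) ≡ pinCount cs
pinCount-mirror []       = refl
pinCount-mirror (c ∷ cs) = cong₂ (λ b n → (if b then 1 else 0) + n) (isRˢ-mirror c) (pinCount-mirror cs)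

boardPinCount-flip : ∀ B → boardPinCount (flipBoard B) ≡ boardPinCount B
boardPinCount-flip []                = refl
boardPinCount-flip (column σ cs ∷ B) =
  cong₂ _+_ (trans (pinCount-reverse (map mirror cs)) (pinCount-mirror cs)) (boardPinCount-flip B)

alternate : Cell → Cell → ℕ → List Cell
alternate a b zero    = []
alternate a b (suc k) = a ∷ b ∷ alternate a b k

alternate-shift : ∀ a b k → alternate a b (suc k) ≡ a ∷ alternate b a k ++ b ∷ []
alternate-shift a b zero    = refl
alternate-shift a b (suc k) = cong (λ xs → a ∷ b ∷ xs) (alternate-shift a b k)

alternate-snoc : ∀ a b k → alternate a b (suc k) ≡ alternate a b k ++ a ∷ b ∷ []
alternate-snoc a b zero    = refl
alternate-snoc a b (suc k) = cong (λ xs → a ∷ b ∷ xs) (alternate-snoc a b k)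

alternate-∷ : ∀ a b k → a ∷ alternate b a k ≡ alternate a b k ++ a ∷ []
alternate-∷ a b zero    = refl
alternate-∷ a b (suc k) = cong (λ xs → a ∷ b ∷ xs) (alternate-∷ a b k)

length-alternate : ∀ a b k → length (alternate a b k) ≡ k + k
length-alternate a b zero    = refl
length-alternate a b (suc k) = cong suc (trans (cong suc (length-alternate a b k)) (sym (+-suc k k)))

last-alternate : ∀ a b k → last (alternate a b (suc k)) ≡ just b
last-alternate a b zero    = refl
last-alternate a b (suc k) = last-alternate a b k

module _ {R : Cell → Cell → Set} {a b : Cell} where

  alternate-pointwise : ∀ {c d xs ys} k → R a c → R b d → Pointwise R xs ys →
                        Pointwise R (alternate a b k ++ xs) (alternate c d k ++ ys)
  alternate-pointwise zero    _   _   rest = rest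
  alternate-pointwise (suc k) rac rbd rest = rac ∷ rbd ∷ alternate-pointwise k rac rbd rest

  alternate-linked : ∀ {xs} k → R a b → R b a → Connected R (just b) (head xs) → Linked R xs →
                     Linked R (alternate a b k ++ xs)
  alternate-linked zero          _   _   _    rest = rest
  alternate-linked (suc zero)    rab _   next rest = rab ∷ (next ∷′ rest)
  alternate-linked (suc (suc k)) rab rba next rest = rab ∷ rba ∷ alternate-linked (suc k) rab rba next rest

alternate-linked₀ : ∀ {R : Cell → Cell → Set} {a b} k → R a b → R b a → Linked R (alternate a b k)
alternate-linked₀ {a = a} {b} k rab rba =
  subst (Linked _) (++-identityʳ (alternate a b k)) (alternate-linked k rab rba just-nothing [])

alternate-all : ∀ {P : Cell → Set} {a b} k → P a → P b → All P (alternate a b k)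
alternate-all zero    _  _  = []
alternate-all (suc k) pa pb = pa ∷ pb ∷ alternate-all k pa pb

pinCount-alternate : ∀ a b k → isRˢ a ≡ false → isRˢ b ≡ false → pinCount (alternate a b k) ≡ 0
pinCount-alternate a b zero    _  _  = refl
pinCount-alternate a b (suc k) ea eb rewrite ea | eb = pinCount-alternate a b k ea eb

-- Odd blocks

rl rlˢ du ud : ℕ → List Cell
rl  = alternate R L
rlˢ = alternate Rˢ Lˢ
du  = alternate D U
ud  = alternate U D

stripes : Sweep → ℕ → Board
stripes σ zero    = []
stripes σ (suc p) = column σ (Rˢ ∷ R ∷ []) ∷ column σ (Lˢ ∷ L ∷ []) ∷ stripes σ p

westColumn : ℕ → Column
westColumn m = column ↓ (Rˢ ∷ du m ++ R ∷ [])

eastColumn : Sweep → ℕ → Column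
eastColumn σ m = column σ (du (suc m))

ringTop ringBottom : ℕ → List Cell
ringTop    n = Lˢ ∷ rl (suc n)
ringBottom n = L ∷ rl (suc n)

ring : Sweep → ℕ → ℕ → Board → Board
ring σ m p B = onTop (ringTop (m + p)) (onBottom (ringBottom (m + p)) (westColumn m ∷ B)) ++ eastColumn σ (suc m) ∷ []

oddRest : Sweep → ℕ → ℕ → Board
oddRest σ zero    p = column σ (Lˢ ∷ L ∷ []) ∷ stripes σ p ++ eastColumn σ 0 ∷ []
oddRest σ (suc m) p = ring σ m p (oddRest σ m p)

oddBlock : Sweep → ℕ → ℕ → Board
oddBlock σ m p = westColumn m ∷ oddRest σ m p

oddTop : ℕ → ℕ → List Cell
oddTop zero    p = Rˢ ∷ Lˢ ∷ rlˢ p ++ D ∷ []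
oddTop (suc m) p = Rˢ ∷ ringTop (m + p) ++ D ∷ []

oddBottom : ℕ → ℕ → List Cell
oddBottom m p = rl (suc (m + p)) ++ U ∷ []

record OddShape (σ : Sweep) (m p : ℕ) (B : Board) : Set where
  field
    width    : length (westColumn m ∷ B) ≡ 3 + 2 * (m + p)
    top      : topRow (westColumn m ∷ B) ≡ map just (oddTop m p)
    bottom   : bottomRow (westColumn m ∷ B) ≡ map just (oddBottom m p)
    east     : last (westColumn m ∷ B) ≡ just (eastColumn σ m)
    coherent : Coherent (suc m + suc m) (westColumn m ∷ B)
    pins     : boardPinCount (westColumn m ∷ B) ≡ suc m + p

length-stripes : ∀ σ p → length (stripes σ p) ≡ p + p
length-stripes σ zero    = refl
length-stripes σ (suc p) = cong suc (trans (cong suc (length-stripes σ p)) (sym (+-suc p p)))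

topRow-stripes : ∀ σ p → topRow (stripes σ p) ≡ map just (rlˢ p)
topRow-stripes σ zero    = refl
topRow-stripes σ (suc p) = cong (λ xs → just Rˢ ∷ just Lˢ ∷ xs) (topRow-stripes σ p)

bottomRow-stripes : ∀ σ p → bottomRow (stripes σ p) ≡ map just (rl p)
bottomRow-stripes σ zero    = refl
bottomRow-stripes σ (suc p) = cong (λ xs → just R ∷ just L ∷ xs) (bottomRow-stripes σ p)

length-ring : ∀ a b c n → length (a ∷ alternate b c (suc n)) ≡ 3 + 2 * n
length-ring a b c n = trans (cong suc (length-alternate b c (suc n))) (arith n)
  where
  arith : ∀ n → suc (suc n + suc n) ≡ 3 + 2 * n
  arith = solve-∀

private
  dominoes : Sweep → ℕ → Board
  dominoes σ p = column σ (Lˢ ∷ L ∷ []) ∷ stripes σ p ++ eastColumn σ 0 ∷ []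

  dominoes-coherent : ∀ σ p → Coherent 2 (dominoes σ p)
  dominoes-coherent σ zero = record
    { heights  = refl ∷ refl ∷ []
    ; stacked  = stacked-robust {σ} (tt ∷ [-]) ∷ stacked-robust {σ} (tt ∷ [-]) ∷ []
    ; abutting = abut-robust {σ} {σ} (tt ∷ tt ∷ []) ∷ [-]
    }
  dominoes-coherent σ (suc p) = record
    { heights  = refl ∷ refl ∷ Coherent.heights rest
    ; stacked  = stacked-robust {σ} (tt ∷ [-]) ∷ stacked-robust {σ} (tt ∷ [-]) ∷ Coherent.stacked rest
    ; abutting = abut-robust {σ} {σ} (tt ∷ tt ∷ []) ∷ abut-robust {σ} {σ} (tt ∷ tt ∷ []) ∷ Coherent.abutting rest
    }
    where rest = dominoes-coherent σ p

  dominoes-pins : ∀ σ p → boardPinCount (dominoes σ p) ≡ p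
  dominoes-pins σ zero    = refl
  dominoes-pins σ (suc p) = cong suc (dominoes-pins σ p)

base-shape : ∀ σ p → OddShape σ 0 p (oddRest σ 0 p)
base-shape σ p = record
  { width    = cong (suc ∘ suc) (trans (length-++ (stripes σ p)) (trans (cong (_+ 1) (length-stripes σ p)) (arith p)))
  ; top      = cong (λ xs → just Rˢ ∷ just Lˢ ∷ xs) (begin
      topRow (stripes σ p ++ eastColumn σ 0 ∷ []) ≡⟨ map-++ (head ∘ cells) (stripes σ p) _ ⟩
      topRow (stripes σ p) ++ just D ∷ []         ≡⟨ cong (_++ just D ∷ []) (topRow-stripes σ p) ⟩
      map just (rlˢ p) ++ just D ∷ []             ≡⟨ map-++ just (rlˢ p) _ ⟨
      map just (rlˢ p ++ D ∷ [])                  ∎)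
  ; bottom   = cong (λ xs → just R ∷ just L ∷ xs) (begin
      bottomRow (stripes σ p ++ eastColumn σ 0 ∷ []) ≡⟨ map-++ (last ∘ cells) (stripes σ p) _ ⟩
      bottomRow (stripes σ p) ++ just U ∷ []         ≡⟨ cong (_++ just U ∷ []) (bottomRow-stripes σ p) ⟩
      map just (rl p) ++ just U ∷ []                 ≡⟨ map-++ just (rl p) _ ⟨
      map just (rl p ++ U ∷ [])                      ∎)
  ; east     = last-++ (westColumn 0 ∷ column σ (Lˢ ∷ L ∷ []) ∷ stripes σ p)
  ; coherent = record
      { heights  = refl ∷ Coherent.heights (dominoes-coherent σ p)
      ; stacked  = (tt ∷ [-]) ∷ Coherent.stacked (dominoes-coherent σ p)
      ; abutting = abut-robust {↓} {σ} (tt ∷ tt ∷ []) ∷ Coherent.abutting (dominoes-coherent σ p)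
      }
  ; pins     = cong suc (dominoes-pins σ p)
  }
  where
  open ≡-Reasoning
  arith : ∀ p → p + p + 1 ≡ 1 + 2 * p
  arith = solve-∀

staggered : ∀ m → Pointwise (λ a b → T (horizontalOK ↓ ↓ a b)) (du (suc m)) (Rˢ ∷ du m ++ R ∷ [])
staggered m = subst (λ xs → Pointwise (λ a b → T (horizontalOK ↓ ↓ a b)) xs (Rˢ ∷ du m ++ R ∷ []))
                (sym (alternate-shift D U m)) (tt ∷ alternate-pointwise m tt tt (tt ∷ []))

ringTopSeam : ∀ {a b} k → T (robustV L a) → T (robustV R b) →
              Pointwise (λ a b → T (robustV a b)) (L ∷ rl k) (alternate a b k ++ D ∷ [])
ringTopSeam {a} {b} k La Rb = subst (λ xs → Pointwise (λ a b → T (robustV a b)) xs (alternate a b k ++ D ∷ []))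
                                (sym (alternate-∷ L R k)) (alternate-pointwise k La Rb (tt ∷ []))

ringTopFits : ∀ m p → Pointwise (λ a b → T (robustV a b)) (ringTop (m + p)) (oddTop m p)
ringTopFits zero    p = tt ∷ tt ∷ ringTopSeam p tt tt
ringTopFits (suc m) p = tt ∷ tt ∷ ringTopSeam (suc (m + p)) tt tt

ringBottomFits : ∀ m p → Pointwise (λ a b → T (robustV a b)) (oddBottom m p) (ringBottom (m + p))
ringBottomFits m p = subst (Pointwise (λ a b → T (robustV a b)) (oddBottom m p)) (sym (alternate-∷ L R (suc (m + p))))
                       (alternate-pointwise (suc (m + p)) tt tt (tt ∷ []))

sameSweep-DU : ∀ σ → T (horizontalOK σ σ D U)
sameSweep-DU ↓ = tt
sameSweep-DU ↑ = tt

sameSweep-UD : ∀ σ → T (horizontalOK σ σ U D)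
sameSweep-UD ↓ = tt
sameSweep-UD ↑ = tt

ring-shape : ∀ {σ m p B} → OddShape σ m p B → OddShape σ (suc m) p (ring σ m p B)
ring-shape {σ} {m} {p} {B} shape = record
  { width    = begin
      suc (length (middle ++ eastmost ∷ []))  ≡⟨ cong suc (length-++ middle) ⟩
      suc (length middle + 1)              ≡⟨ cong (λ k → suc (k + 1)) (trans middleWidth width) ⟩
      suc (3 + 2 * n + 1)                  ≡⟨ arith n ⟩
      3 + 2 * suc n                        ∎
  ; top      = cong (just Rˢ ∷_) (begin
      topRow (middle ++ eastmost ∷ [])        ≡⟨ map-++ (head ∘ cells) middle _ ⟩
      topRow middle ++ just D ∷ []        ≡⟨ cong (_++ just D ∷ []) (topRow-onTop {ringTop n} {lower} topWidth) ⟩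
      map just (ringTop n) ++ just D ∷ [] ≡⟨ map-++ just (ringTop n) _ ⟨
      map just (ringTop n ++ D ∷ [])      ∎)
  ; bottom   = cong₂ _∷_ (last-++ (Rˢ ∷ du (suc m))) (begin
      bottomRow (middle ++ eastmost ∷ [])        ≡⟨ map-++ (last ∘ cells) middle _ ⟩
      bottomRow middle ++ last (du (suc (suc m))) ∷ []
        ≡⟨ cong₂ (λ xs u → xs ++ u ∷ []) (bottomRow-onTop-onBottom {ringTop n} {ringBottom n} {inner} (rowWidth Lˢ) (rowWidth L))
                                           (last-alternate D U (suc m)) ⟩
      map just (ringBottom n) ++ just U ∷ [] ≡⟨ map-++ just (ringBottom n) _ ⟨
      map just (ringBottom n ++ U ∷ [])      ∎)
  ; east     = last-++ (westColumn (suc m) ∷ middle)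
  ; coherent = subst (λ h → Coherent h (westColumn (suc m) ∷ middle ++ eastmost ∷ []))
                     (cong suc (sym (+-suc (suc m) (suc m))))
                 (coherent-++ westCoherent (coherent-++ middleCoherent eastCoherent eastSeam) westSeam)
  ; pins     = begin
      suc (pinCount (du (suc m) ++ R ∷ []) + boardPinCount (middle ++ eastmost ∷ []))
        ≡⟨ cong₂ (λ a b → suc (a + b)) (trans (pinCount-++ (du (suc m)) _) (cong (_+ 0) (pinCount-alternate D U (suc m) refl refl)))
                                      (boardPinCount-++ middle _) ⟩
      suc (boardPinCount middle + (pinCount (du (suc (suc m))) + 0))
        ≡⟨ cong₂ (λ a b → suc (a + (b + 0))) middlePins (pinCount-alternate D U (suc (suc m)) refl refl) ⟩
      suc (suc m + p + 0 + 0)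
        ≡⟨ cong suc (trans (+-identityʳ _) (+-identityʳ _)) ⟩
      suc (suc m + p) ∎
  }
  where
  open ≡-Reasoning
  open OddShape shape
  n = m + p
  inner lower middle : Board
  inner  = westColumn m ∷ B
  lower  = onBottom (ringBottom n) inner
  middle = onTop (ringTop n) lower
  eastmost : Column
  eastmost = eastColumn σ (suc m)
  rowWidth : ∀ a → length (a ∷ rl (suc n)) ≡ length inner
  rowWidth a = trans (length-ring a R L n) (sym width)
  lowerWidth : length lower ≡ length inner
  lowerWidth = length-onBottom {ringBottom n} {inner} (rowWidth L)
  topWidth : length (ringTop n) ≡ length lower
  topWidth = trans (rowWidth Lˢ) (sym lowerWidth)
  middleWidth : length middle ≡ length inner
  middleWidth = trans (length-onTop {ringTop n} {lower} topWidth) lowerWidth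
  arith : ∀ n → suc (3 + 2 * n + 1) ≡ 3 + 2 * suc n
  arith = solve-∀
  H : ℕ
  H = suc m + suc m
  lowerCoherent : Coherent (suc H) lower
  lowerCoherent = coherent-onBottom coherent (rowWidth L)
    (robust-bottomSeam bottom (ringBottomFits m p))
    (robust-rowChain {inner} {ringBottom n} (tt ∷ alternate-linked₀ (suc n) tt tt))
  middleCoherent : Coherent (suc (suc H)) middle
  middleCoherent = coherent-onTop lowerCoherent topWidth
    (robust-topSeam (trans (topRow-onBottom {r = ringBottom n} {inner} (rowWidth L) (Coherent.heights coherent)) top)
                    (ringTopFits m p))
    (robust-rowChain {lower} {ringTop n} (tt ∷ alternate-linked₀ (suc n) tt tt))
  westCoherent : Coherent (suc (suc H)) (westColumn (suc m) ∷ [])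
  westCoherent = coherent-single (cong suc (trans (length-++ (du (suc m))) (trans (cong (_+ 1) (length-alternate D U (suc m)))
                                                                    (+-comm H 1))))
                        (tt ∷ alternate-linked (suc m) tt tt (just tt) [-])
  eastCoherent : Coherent (suc (suc H)) (eastmost ∷ [])
  eastCoherent = coherent-single (trans (length-alternate D U (suc (suc m))) (cong suc (+-suc (suc m) (suc m))))
                        (stacked-robust {σ} (alternate-linked₀ (suc (suc m)) tt tt))
  westSeam : Connected Abut (just (westColumn (suc m))) (head (middle ++ eastmost ∷ []))
  westSeam = just (tt ∷ Pointwise.++⁺ (staggered m) (tt ∷ []))
  lastMiddle : last middle ≡ just (column σ (L ∷ du (suc m) ++ L ∷ []))
  lastMiddle = last-onTop {ringTop n} {lower} topWidth (last-alternate R L n)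
                 (last-onBottom {ringBottom n} {inner} (rowWidth L) (last-alternate R L n) east)
  eastSeam : Connected Abut (last middle) (just eastmost)
  eastSeam = subst (λ c → Connected Abut c (just eastmost)) (sym lastMiddle) (just
    (subst (Pointwise (λ a b → T (horizontalOK σ σ a b)) (L ∷ du (suc m) ++ L ∷ [])) (sym (alternate-shift D U (suc m)))
      (robustH-ok {L} {D} tt σ σ ∷
         alternate-pointwise (suc m) (sameSweep-DU σ) (sameSweep-UD σ) (robustH-ok {L} {U} tt σ σ ∷ []))))
  middlePins : boardPinCount middle ≡ suc m + p + 0
  middlePins = begin
    boardPinCount middle                                     ≡⟨ boardPinCount-onTop {ringTop n} {lower} topWidth ⟩
    pinCount (ringTop n) + boardPinCount lower               ≡⟨ cong (_+ boardPinCount lower) (pinCount-alternate R L (suc n) refl refl) ⟩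
    boardPinCount lower                                      ≡⟨ boardPinCount-onBottom {ringBottom n} {inner} (rowWidth L) ⟩
    boardPinCount inner + pinCount (ringBottom n)            ≡⟨ cong₂ _+_ pins (pinCount-alternate R L (suc n) refl refl) ⟩
    suc m + p + 0                                            ∎

oddShape : ∀ σ m p → OddShape σ m p (oddRest σ m p)
oddShape σ zero    p = base-shape σ p
oddShape σ (suc m) p = ring-shape (oddShape σ m p)

All-just : ∀ {P : Cell → Set} {xs} → All P xs → All (Maybe.All P) (map just xs)
All-just = All.map⁺ ∘ All.map Maybe.just

oddBlock-framed : ∀ σ m p → Framed (oddBlock σ m p)
oddBlock-framed σ m p = record
  { north = subst (All _) (sym top) (All-just (topClear m))
  ; south = subst (All _) (sym bottom) (All-just (All.++⁺ (alternate-all (suc (m + p)) tt tt) (tt ∷ [])))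
  ; west  = Maybe.just (tt ∷ All.++⁺ (alternate-all m tt tt) (tt ∷ []))
  ; east  = subst (Maybe.All _) (sym east) (Maybe.just (alternate-all (suc m) tt tt))
  }
  where
  open OddShape (oddShape σ m p)
  topClear : ∀ m → All (Not pointsUp) (oddTop m p)
  topClear zero    = tt ∷ tt ∷ All.++⁺ (alternate-all p tt tt) (tt ∷ [])
  topClear (suc m) = tt ∷ tt ∷ All.++⁺ (alternate-all (suc (m + p)) tt tt) (tt ∷ [])

eastColumn-coherent : ∀ σ m → Coherent (suc m + suc m) (eastColumn σ m ∷ [])
eastColumn-coherent σ m = coherent-single (length-alternate D U (suc m)) (stacked-robust {σ} (alternate-linked₀ (suc m) tt tt))

eastColumn-framed : ∀ σ m → Framed (eastColumn σ m ∷ [])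
eastColumn-framed σ m = record
  { north = Maybe.just tt ∷ []
  ; south = subst (Maybe.All _) (sym (last-alternate D U m)) (Maybe.just tt) ∷ []
  ; west  = Maybe.just (alternate-all (suc m) tt tt)
  ; east  = Maybe.just (alternate-all (suc m) tt tt)
  }

-- Chains of blocks

blocks : ℕ → ℕ → ℕ → Board
blocks m p zero    = oddBlock ↓ m p
blocks m p (suc j) = oddBlock ↓ m 0 ++ blocks m p j

head-blocks : ∀ m p j → head (blocks m p j) ≡ just (westColumn m)
head-blocks m p zero    = refl
head-blocks m p (suc j) = refl

eastWestSeam : ∀ m {B} → head B ≡ just (westColumn m) → Connected Abut (just (eastColumn ↓ m)) (head B)
eastWestSeam m e = subst (Connected Abut _) (sym e) (just (staggered m))

module _ (m p : ℕ) where

  blocks-coherent : ∀ j → Coherent (suc m + suc m) (blocks m p j)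
  blocks-coherent zero    = OddShape.coherent (oddShape ↓ m p)
  blocks-coherent (suc j) = coherent-++ (OddShape.coherent (oddShape ↓ m 0)) (blocks-coherent j)
    (subst (λ c → Connected Abut c (head (blocks m p j))) (sym (OddShape.east (oddShape ↓ m 0)))
           (eastWestSeam m (head-blocks m p j)))

  blocks-framed : ∀ j → Framed (blocks m p j)
  blocks-framed zero    = oddBlock-framed ↓ m p
  blocks-framed (suc j) = framed-++ (oddBlock-framed ↓ m 0) (blocks-framed j) (head-blocks m p j)

  blocks-width : ∀ j → length (blocks m p j) ≡ j * (3 + 2 * m) + (3 + 2 * (m + p))
  blocks-width zero    = OddShape.width (oddShape ↓ m p)
  blocks-width (suc j) = begin
    length (oddBlock ↓ m 0 ++ blocks m p j)                    ≡⟨ length-++ (oddBlock ↓ m 0) ⟩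
    length (oddBlock ↓ m 0) + length (blocks m p j)            ≡⟨ cong₂ _+_ (OddShape.width (oddShape ↓ m 0)) (blocks-width j) ⟩
    3 + 2 * (m + 0) + (j * (3 + 2 * m) + (3 + 2 * (m + p))) ≡⟨ arith m j p ⟩
    suc j * (3 + 2 * m) + (3 + 2 * (m + p))               ∎
    where
    open ≡-Reasoning
    arith : ∀ m j p → 3 + 2 * (m + 0) + (j * (3 + 2 * m) + (3 + 2 * (m + p))) ≡ suc j * (3 + 2 * m) + (3 + 2 * (m + p))
    arith = solve-∀

  blocks-pins : ∀ j → boardPinCount (blocks m p j) ≡ j * suc m + (suc m + p)
  blocks-pins zero    = OddShape.pins (oddShape ↓ m p)
  blocks-pins (suc j) = begin
    boardPinCount (oddBlock ↓ m 0 ++ blocks m p j)                  ≡⟨ boardPinCount-++ (oddBlock ↓ m 0) (blocks m p j) ⟩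
    boardPinCount (oddBlock ↓ m 0) + boardPinCount (blocks m p j)   ≡⟨ cong₂ _+_ (OddShape.pins (oddShape ↓ m 0)) (blocks-pins j) ⟩
    suc m + 0 + (j * suc m + (suc m + p))                      ≡⟨ arith m j p ⟩
    suc j * suc m + (suc m + p)                                ∎
    where
    open ≡-Reasoning
    arith : ∀ m j p → suc m + 0 + (j * suc m + (suc m + p)) ≡ suc j * suc m + (suc m + p)
    arith = solve-∀

padded-coherent : ∀ m p j → Coherent (suc m + suc m) (eastColumn ↓ m ∷ blocks m p j)
padded-coherent m p j = coherent-++ (eastColumn-coherent ↓ m) (blocks-coherent m p j) (eastWestSeam m (head-blocks m p j))

padded-framed : ∀ m p j → Framed (eastColumn ↓ m ∷ blocks m p j)
padded-framed m p j = framed-++ (eastColumn-framed ↓ m) (blocks-framed m p j) (head-blocks m p j)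

data Parity : ℕ → Set where
  even : ∀ p → Parity (p + p)
  odd  : ∀ p → Parity (suc (p + p))

parity : ∀ n → Parity n
parity zero = even 0
parity (suc n) with parity n
... | even p = odd p
... | odd  p = subst Parity (cong suc (+-suc p p)) (even (suc p))

half-even : ∀ p → (p + p) / 2 ≡ p
half-even zero    = refl
half-even (suc p) =
  trans (m/n≡1+[m∸n]/n {suc p + suc p} {2} (s≤s (subst (1 ≤_) (sym (+-suc p p)) (s≤s z≤n))))
        (cong suc (trans (cong (λ n → (n ∸ 1) / 2) (+-suc p p)) (half-even p)))

half-odd : ∀ p → suc (p + p) / 2 ≡ p
half-odd zero    = refl
half-odd (suc p) =
  trans (m/n≡1+[m∸n]/n {suc (suc p + suc p)} {2} (s≤s (s≤s z≤n)))
        (cong suc (trans (cong (_/ 2) (+-suc p p)) (half-odd p)))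

stairs : ℕ → ℕ → Board
stairs m q = onBottom (rl (suc (suc (m + q)))) (eastColumn ↓ m ∷ oddBlock ↑ m q)

module _ (m q : ℕ) where

  private
    n : ℕ
    n = m + q
    evenBlock : Board
    evenBlock = eastColumn ↓ m ∷ oddBlock ↑ m q
    shape : OddShape ↑ m q (oddRest ↑ m q)
    shape = oddShape ↑ m q
    rowWidth : length (rl (suc (suc n))) ≡ length evenBlock
    rowWidth = trans (length-alternate R L (suc (suc n))) (trans (arith n) (cong suc (sym (OddShape.width shape))))
      where
      arith : ∀ n → suc (suc n) + suc (suc n) ≡ suc (3 + 2 * n)
      arith = solve-∀

  stairs-width : length (stairs m q) ≡ 4 + 2 * (m + q)
  stairs-width = trans (length-onBottom {rl (suc (suc n))} {evenBlock} rowWidth) (cong suc (OddShape.width shape))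

  stairs-coherent : Coherent (suc (suc m + suc m)) (stairs m q)
  stairs-coherent = coherent-onBottom
    (coherent-++ (eastColumn-coherent ↓ m) (OddShape.coherent shape) (just (staggered m)))
    rowWidth
    (subst (λ c → Connected (Vertical ↓) c (just R)) (sym (last-alternate D U m)) (just tt)
      ∷ robust-bottomSeam (OddShape.bottom shape) (ringBottomFits m q))
    (robust-rowChain {evenBlock} {rl (suc (suc n))} (alternate-linked₀ (suc (suc n)) tt tt))

  private
    evenCoherent : Coherent (suc m + suc m) evenBlock
    evenCoherent = coherent-++ (eastColumn-coherent ↓ m) (OddShape.coherent shape) (just (staggered m))

  last-stairs : last (stairs m q) ≡ just (column ↑ (du (suc m) ++ L ∷ []))
  last-stairs = last-onBottom {rl (suc (suc n))} {evenBlock} rowWidth (last-alternate R L (suc n)) (OddShape.east shape)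

  stairs-framed : Framed (stairs m q)
  stairs-framed = record
    { north = subst (All _) (sym (topRow-onBottom {r = rl (suc (suc n))} {evenBlock} rowWidth (Coherent.heights evenCoherent)))
                (Maybe.just tt ∷ Framed.north (oddBlock-framed ↑ m q))
    ; south = subst (All _) (sym (bottomRow-onBottom {rl (suc (suc n))} {evenBlock} rowWidth))
                (All-just (alternate-all (suc (suc n)) tt tt))
    ; west  = Maybe.just (All.++⁺ (alternate-all (suc m) tt tt) (tt ∷ []))
    ; east  = subst (Maybe.All _) (sym last-stairs) (Maybe.just (All.++⁺ (alternate-all (suc m) tt tt) (tt ∷ [])))
    }

  stairs-pins : boardPinCount (stairs m q) ≡ suc m + q
  stairs-pins = begin
    boardPinCount (stairs m q)                                   ≡⟨ boardPinCount-onBottom {rl (suc (suc n))} {evenBlock} rowWidth ⟩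
    pinCount (du (suc m)) + boardPinCount (oddBlock ↑ m q) + pinCount (rl (suc (suc n)))
      ≡⟨ cong₂ (λ a b → a + boardPinCount (oddBlock ↑ m q) + b) (pinCount-alternate D U (suc m) refl refl)
                                                              (pinCount-alternate R L (suc (suc n)) refl refl) ⟩
    boardPinCount (oddBlock ↑ m q) + 0                           ≡⟨ trans (+-identityʳ _) (OddShape.pins shape) ⟩
    suc m + q                                                    ∎
    where open ≡-Reasoning

mirror-du : ∀ k → map mirror (du k) ≡ ud k
mirror-du zero    = refl
mirror-du (suc k) = cong (λ xs → U ∷ D ∷ xs) (mirror-du k)

reverse-ud : ∀ k → reverse (ud k) ≡ du k
reverse-ud zero    = refl
reverse-ud (suc k) = begin
  reverse (U ∷ D ∷ ud k)        ≡⟨ reverse-++ (U ∷ D ∷ []) (ud k) ⟩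
  reverse (ud k) ++ D ∷ U ∷ []  ≡⟨ cong (_++ D ∷ U ∷ []) (reverse-ud k) ⟩
  du k ++ D ∷ U ∷ []            ≡⟨ alternate-snoc D U k ⟨
  du (suc k)                    ∎
  where open ≡-Reasoning

flip-westStairs : ∀ k → flipColumn (column ↓ (du k ++ R ∷ [])) ≡ column ↑ (R ∷ du k)
flip-westStairs k = cong (column ↑) (begin
  reverse (map mirror (du k ++ R ∷ []))  ≡⟨ cong reverse (map-++ mirror (du k) (R ∷ [])) ⟩
  reverse (map mirror (du k) ++ R ∷ [])  ≡⟨ cong (λ xs → reverse (xs ++ R ∷ [])) (mirror-du k) ⟩
  reverse (ud k ++ R ∷ [])               ≡⟨ reverse-++ (ud k) (R ∷ []) ⟩
  R ∷ reverse (ud k)                     ≡⟨ cong (R ∷_) (reverse-ud k) ⟩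
  R ∷ du k                               ∎)
  where open ≡-Reasoning

zigzag : ℕ → ℕ → ℕ → Board
zigzag m q zero    = stairs m q
zigzag m q (suc j) = stairs m 0 ++ flipBoard (zigzag m q j)

module _ (m q : ℕ) where

  head-flipped : ∀ j → head (flipBoard (zigzag m q j)) ≡ just (column ↑ (R ∷ du (suc m)))
  head-flipped zero    = cong just (flip-westStairs (suc m))
  head-flipped (suc j) = cong just (flip-westStairs (suc m))

  turnSeam : Connected Abut (last (stairs m 0)) (just (column ↑ (R ∷ du (suc m))))
  turnSeam = subst (λ c → Connected Abut c (just (column ↑ (R ∷ du (suc m))))) (sym (last-stairs m 0))
    (just (tt ∷ tt ∷ subst (Pointwise (λ a b → T (horizontalOK ↑ ↑ a b)) (du m ++ L ∷ [])) (sym (alternate-∷ U D m))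
                           (alternate-pointwise m tt tt (tt ∷ []))))

  zigzag-coherent : ∀ j → Coherent (suc (suc m + suc m)) (zigzag m q j)
  zigzag-coherent zero    = stairs-coherent m q
  zigzag-coherent (suc j) = coherent-++ (stairs-coherent m 0) (coherent-flip (zigzag-coherent j))
                              (subst (Connected Abut _) (sym (head-flipped j)) turnSeam)

  zigzag-framed : ∀ j → Framed (zigzag m q j)
  zigzag-framed zero    = stairs-framed m q
  zigzag-framed (suc j) = framed-++ (stairs-framed m 0) (framed-flip (zigzag-framed j)) (head-flipped j)

  zigzag-width : ∀ j → length (zigzag m q j) ≡ j * (4 + 2 * m) + (4 + 2 * (m + q))
  zigzag-width zero    = stairs-width m q
  zigzag-width (suc j) = begin
    length (stairs m 0 ++ flipBoard (zigzag m q j))          ≡⟨ length-++ (stairs m 0) ⟩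
    length (stairs m 0) + length (flipBoard (zigzag m q j))
      ≡⟨ cong₂ _+_ (stairs-width m 0) (trans (length-map flipColumn (zigzag m q j)) (zigzag-width j)) ⟩
    4 + 2 * (m + 0) + (j * (4 + 2 * m) + (4 + 2 * (m + q)))  ≡⟨ arith m j q ⟩
    suc j * (4 + 2 * m) + (4 + 2 * (m + q))                  ∎
    where
    open ≡-Reasoning
    arith : ∀ m j q → 4 + 2 * (m + 0) + (j * (4 + 2 * m) + (4 + 2 * (m + q))) ≡ suc j * (4 + 2 * m) + (4 + 2 * (m + q))
    arith = solve-∀

  zigzag-pins : ∀ j → boardPinCount (zigzag m q j) ≡ j * suc m + (suc m + q)
  zigzag-pins zero    = stairs-pins m q
  zigzag-pins (suc j) = begin
    boardPinCount (stairs m 0 ++ flipBoard (zigzag m q j))   ≡⟨ boardPinCount-++ (stairs m 0) (flipBoard (zigzag m q j)) ⟩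
    boardPinCount (stairs m 0) + boardPinCount (flipBoard (zigzag m q j))
      ≡⟨ cong₂ _+_ (stairs-pins m 0) (trans (boardPinCount-flip (zigzag m q j)) (zigzag-pins j)) ⟩
    suc m + 0 + (j * suc m + (suc m + q))                    ≡⟨ arith m j q ⟩
    suc j * suc m + (suc m + q)                              ∎
    where
    open ≡-Reasoning
    arith : ∀ m j q → suc m + 0 + (j * suc m + (suc m + q)) ≡ suc j * suc m + (suc m + q)
    arith = solve-∀

dominoRow : ℕ → Board
dominoRow n = map (λ c → column ↓ (c ∷ [])) (rl n)

dominoRow-coherent : ∀ n → Coherent 1 (dominoRow n)
dominoRow-coherent n = record
  { heights  = All.map⁺ (alternate-all {P = λ c → length (c ∷ []) ≡ 1} n refl refl)
  ; stacked  = All.map⁺ (alternate-all {P = λ c → Stacked (column ↓ (c ∷ []))} n [-] [-])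
  ; abutting = Linked.map⁺ (alternate-linked₀ {R = λ a b → Abut (column ↓ (a ∷ [])) (column ↓ (b ∷ []))}
                                              n (tt ∷ []) (tt ∷ []))
  }

dominoRow-framed : ∀ n → Framed (dominoRow (suc n))
dominoRow-framed n = record
  { north = All.map⁺ (All.map⁺ (alternate-all (suc n) (Maybe.just tt) (Maybe.just tt)))
  ; south = All.map⁺ (All.map⁺ (alternate-all (suc n) (Maybe.just tt) (Maybe.just tt)))
  ; west  = Maybe.just (tt ∷ [])
  ; east  = subst (Maybe.All _) (sym (trans (last-map _ (rl (suc n))) (cong (Data.Maybe.map _) (last-alternate R L n))))
              (Maybe.just (tt ∷ []))
  }

dominoRow-pins : ∀ n → boardPinCount (dominoRow n) ≡ 0
dominoRow-pins zero    = refl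
dominoRow-pins (suc n) = dominoRow-pins n

blocksBound : ∀ m j p → ForcingNumber≤ (Grid (2 * suc m) ((2 * suc m + 1) * suc j + (p + p))) (suc m * suc j + p)
blocksBound m j p =
  forcingBound (blocks m p j) (subst (λ h → Coherent h (blocks m p j)) (height m) (blocks-coherent m p j))
    (blocks-framed m p j) (trans (blocks-width m p j) (width m j p)) (≤-reflexive (trans (blocks-pins m p j) (pins m j p)))
  where
  height : ∀ m → suc m + suc m ≡ 2 * suc m
  height = solve-∀
  width : ∀ m j p → j * (3 + 2 * m) + (3 + 2 * (m + p)) ≡ (2 * suc m + 1) * suc j + (p + p)
  width = solve-∀
  pins : ∀ m j p → j * suc m + (suc m + p) ≡ suc m * suc j + p
  pins = solve-∀

paddedBlocksBound : ∀ m j p → ForcingNumber≤ (Grid (2 * suc m) ((2 * suc m + 1) * suc j + suc (p + p))) (suc m * suc j + p)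
paddedBlocksBound m j p =
  forcingBound (eastColumn ↓ m ∷ blocks m p j)
    (subst (λ h → Coherent h (eastColumn ↓ m ∷ blocks m p j)) (height m) (padded-coherent m p j))
    (padded-framed m p j) (trans (cong suc (blocks-width m p j)) (width m j p))
    (≤-reflexive (trans (cong (_+ boardPinCount (blocks m p j)) (pinCount-alternate D U m refl refl))
                        (trans (blocks-pins m p j) (pins m j p))))
  where
  height : ∀ m → suc m + suc m ≡ 2 * suc m
  height = solve-∀
  width : ∀ m j p → suc (j * (3 + 2 * m) + (3 + 2 * (m + p))) ≡ (2 * suc m + 1) * suc j + suc (p + p)
  width = solve-∀
  pins : ∀ m j p → j * suc m + (suc m + p) ≡ suc m * suc j + p
  pins = solve-∀

evenHeightBound : ∀ m j r → ForcingNumber≤ (Grid (2 * suc m) ((2 * suc m + 1) * suc j + r)) (suc m * suc j + r / 2)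
evenHeightBound m j r with parity r
... | even p = subst (ForcingNumber≤ _) (cong (suc m * suc j +_) (sym (half-even p))) (blocksBound m j p)
... | odd  p = subst (ForcingNumber≤ _) (cong (suc m * suc j +_) (sym (half-odd p))) (paddedBlocksBound m j p)

oddHeightBound : ∀ k j r → ForcingNumber≤ (Grid (2 * k + 1) ((2 * k + 2) * suc j + 2 * r)) (k * suc j + r)
oddHeightBound zero j r =
  forcingBound (dominoRow (suc (j + r))) (dominoRow-coherent (suc (j + r))) (dominoRow-framed (j + r))
    (trans (length-map _ (rl (suc (j + r)))) (trans (length-alternate R L (suc (j + r))) (width j r)))
    (subst (_≤ r) (sym (dominoRow-pins (suc (j + r)))) z≤n)
  where
  width : ∀ j r → suc (j + r) + suc (j + r) ≡ (2 * 0 + 2) * suc j + 2 * r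
  width = solve-∀
oddHeightBound (suc m) j r =
  forcingBound (zigzag m r j) (subst (λ h → Coherent h (zigzag m r j)) (height m) (zigzag-coherent m r j))
    (zigzag-framed m r j) (trans (zigzag-width m r j) (width m j r)) (≤-reflexive (trans (zigzag-pins m r j) (pins m j r)))
  where
  height : ∀ m → suc (suc m + suc m) ≡ 2 * suc m + 1
  height = solve-∀
  width : ∀ m j r → j * (4 + 2 * m) + (4 + 2 * (m + r)) ≡ (2 * suc m + 2) * suc j + 2 * r
  width = solve-∀
  pins : ∀ m j r → j * suc m + (suc m + r) ≡ suc m * suc j + r
  pins = solve-∀

mainTheorem12 :
    (∀ (k l r : ℕ) → 1 ≤ k → 1 ≤ l → r ≤ 2 * k →
      ForcingNumber≤ (Grid (2 * k) ((2 * k + 1) * l + r)) (k * l + r / 2))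
    ×
    (∀ (k l r : ℕ) → 1 ≤ l → 2 * r ≤ 2 * k + 1 →
      ForcingNumber≤ (Grid (2 * k + 1) ((2 * k + 2) * l + 2 * r)) (k * l + r))
mainTheorem12 =
  (λ { (suc m) (suc j) r _ _ _ → evenHeightBound m j r }) ,
  (λ { k (suc j) r _ _ → oddHeightBound k j r })
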